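{- Let $m \geq 1$ and $n = 2^m$. Then the hypercube $Q_n$ can be decomposed into cycles $C_1, C_2, \dots, C_r$, each of length $2^m n$, where $r = 2^{n-1-m}$, such that (I) every $C_i$ contains $2^m$ edges $e_{i1}, e_{i2}, \dots, e_{i2^m}$ such that $C_i - \{e_{i1}, \dots, e_{i2^m}\}$ has exactly $2^m$ components, each of which is a path of length $n-1$; and (II) the set $M = \{e_{ij} : j = 1, \dots, 2^m;\ i = 1, \dots, r\}$ is a perfect matching of $Q_n$.
   Context: $Q_n$ is the $n$-dimensional hypercube (vertices: binary $n$-tuples; edges: pairs differing in exactly one coordinate). A decomposition into cycles means a partition of the edge set into edge sets of cycles. Lengths are numbers of edges. A perfect matching is a set of pairwise vertex-disjoint edges covering every vertex. -}

module Defs where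

open import Data.Bool using (Bool)
open import Data.Nat using (ℕ; zero; suc; _≤_; _^_; _*_; _∸_)
open import Data.Nat.DivMod using (_%_; m%n<n)
open import Data.Fin using (Fin; toℕ; fromℕ<; inject₁) renaming (suc to fsuc)
open import Data.Vec using (Vec; lookup)
open import Data.Product using (Σ; ∃; _×_; _,_)
open import Data.Sum using (_⊎_)
open import Relation.Binary.PropositionalEquality using (_≡_; _≢_)
open import Relation.Nullary using (¬_)
open import Function.Definitions using (Injective)

Vertex : ℕ → Set
Vertex n = Vec Bool n

Adjacent : ∀ {n} → Vertex n → Vertex n → Set
Adjacent {n} u v =
  Σ (Fin n) λ i → (lookup u i ≢ lookup v i) × (∀ j → j ≢ i → lookup u j ≡ lookup v j)

SameEdge : ∀ {n} → Vertex n → Vertex n → Vertex n → Vertex n → Set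
SameEdge a b u v = (a ≡ u × b ≡ v) ⊎ (a ≡ v × b ≡ u)

next : ∀ {L} → Fin L → Fin L
next {suc L} i = fromℕ< (m%n<n (suc (toℕ i)) (suc L))

-- A cycle of length L (L ≥ 3) in Q_n: distinct vertices v_0,…,v_{L-1},
-- with v_k adjacent to v_{k+1 mod L}. Its k-th edge is {v_k, v_{k+1 mod L}}.
record Cycle (n L : ℕ) : Set where
  field
    len≥3 : 3 ≤ L
    vert  : Fin L → Vertex n
    inj   : Injective _≡_ _≡_ vert
    adj   : ∀ k → Adjacent (vert k) (vert (next k))
open Cycle public

EdgeOfCycle : ∀ {n L} → Cycle n L → Vertex n → Vertex n → Set
EdgeOfCycle C u v = ∃ λ k → SameEdge u v (vert C k) (vert C (next k))

record Path (n ℓ : ℕ) : Set where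
  field
    pvert : Fin (suc ℓ) → Vertex n
    pinj  : Injective _≡_ _≡_ pvert
    padj  : ∀ (s : Fin ℓ) → Adjacent (pvert (inject₁ s)) (pvert (fsuc s))
open Path public

-- Decomposition of Q_n into the cycles C_1..C_r: every edge of Q_n lies in
-- exactly one C_i (edges of each C_i are edges of Q_n by Cycle.adj).
Decomposition : ∀ {n L r} → (Fin r → Cycle n L) → Set
Decomposition {n} {L} {r} C =
  ∀ (u v : Vertex n) → Adjacent u v →
    Σ (Fin r) λ i → EdgeOfCycle (C i) u v × (∀ j → EdgeOfCycle (C j) u v → j ≡ i)

-- C - {edges at positions p(1..K)} has exactly K components, each of which is a
-- path of length ℓ: there are K paths P_1..P_K (subgraphs of C - E') whose vertex
-- sets partition V(C) and whose edges are exactly the remaining edges of C.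
-- (Paths are connected and every remaining edge lies inside one P_a, so the
-- P_a are precisely the components.)
ComponentsArePaths : ∀ {n L K} → Cycle n L → (Fin K → Fin L) → ℕ → Set
ComponentsArePaths {n} {L} {K} C p ℓ =
  Σ (Fin K → Path n ℓ) λ P →
    (∀ (k : Fin L) → Σ (Fin K × Fin (suc ℓ)) λ { (a , t) →
        (pvert (P a) t ≡ vert C k) ×
        (∀ b t' → pvert (P b) t' ≡ vert C k → (b , t') ≡ (a , t)) })
    × (∀ a t → ∃ λ k → pvert (P a) t ≡ vert C k)
    × (∀ a (s : Fin ℓ) → ∃ λ k → (∀ j → p j ≢ k) ×
         SameEdge (pvert (P a) (inject₁ s)) (pvert (P a) (fsuc s)) (vert C k) (vert C (next k)))
    × (∀ k → (∀ j → p j ≢ k) → Σ (Fin K × Fin ℓ) λ { (a , s) →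
         SameEdge (pvert (P a) (inject₁ s)) (pvert (P a) (fsuc s)) (vert C k) (vert C (next k)) })

OnEdge : ∀ {n L} → Cycle n L → Fin L → Vertex n → Set
OnEdge C k v = (v ≡ vert C k) ⊎ (v ≡ vert C (next k))

-- M = { e_ij } with e_ij the p i j -th edge of C_i is a perfect matching of Q_n:
-- every vertex lies on exactly one e_ij (the e_ij are edges of Q_n, and they are
-- pairwise distinct, as M consists of r·K distinct edges).
PerfectMatching : ∀ {n L r K} → (Fin r → Cycle n L) → (Fin r → Fin K → Fin L) → Set
PerfectMatching {n} {L} {r} {K} C p =
  ∀ (v : Vertex n) → Σ (Fin r × Fin K) λ { (i , j) →
    OnEdge (C i) (p i j) v × (∀ i' j' → OnEdge (C i') (p i' j') v → (i' , j') ≡ (i , j)) }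

module Submission where

-- The theorem is proved for a stronger, self-reproducing structure: a decomposition of Q_d
-- (d = 2^m) into cycles of length d², each cut into d segments (paths of d vertices) so that
-- every vertex is an end of exactly one segment. The edges joining consecutive segments then
-- form a perfect matching, and deleting them leaves the segments as components.
--
-- Such a decomposition of Q_d yields one of Q_{2d} = Q_d □ Q_d. For cycles C, C′ and β < d/2,
-- a new cycle has 2d segments; its segment (e, α) first follows segment α of C in the first
-- coordinate, with the second coordinate resting at the start of a segment λ of C′, and then
-- follows one segment of C′, forwards or backwards, with the first coordinate resting at the
-- end of segment α. The resting segments λ advance by +1 during the first quarter of the
-- segments and by -1 afterwards, which after d segments amounts to a shift by d/2, so the
-- cycle closes after 2d segments; β and e fix the starting λ. Repeating the construction with
-- C′ reversed handles the vertices whose second coordinate is a segment end instead of a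
-- start. The decompositions of Q_2 and Q_4 that start the induction are checked by
-- computation.

open import Defs
open import Data.Bool as Bool using (Bool; true; false; not; _xor_; if_then_else_; _∧_; T)
open import Data.Bool.Properties using (not-involutive; xor-identityʳ; xor-comm; true-xor)
open import Data.Empty using (⊥-elim)
open import Data.Fin as Fin using (Fin; toℕ; fromℕ; fromℕ<; opposite; inject₁; lower₁; _↑ˡ_; _↑ʳ_; combine; remQuot)
  renaming (zero to fz; suc to fs)
open import Data.Fin.Properties
  using ( toℕ-injective; toℕ-fromℕ<; toℕ<n; toℕ-fromℕ; toℕ-↑ˡ; toℕ-↑ʳ; toℕ-inject₁; toℕ-combine
        ; splitAt-↑ˡ; splitAt-↑ʳ; join-splitAt; splitAt⁻¹-↑ˡ; splitAt⁻¹-↑ʳ; ↑ˡ-injective; ↑ʳ-injective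
        ; opposite-prop; opposite-involutive; remQuot-combine; combine-remQuot
        ; fromℕ≢inject₁; inject₁-lower₁; all?; any?; 2↔Bool; *↔× )
open import Data.Nat as ℕ using (ℕ; zero; suc; _+_; _*_; _∸_; _^_; _<_; _≤_; z≤n; s≤s; _%_; _≡ᵇ_; _<ᵇ_)
open import Data.Nat.DivMod
open import Data.Nat.Properties
open import Data.Nat.Tactic.RingSolver using (solve-∀)
open import Data.Product using (Σ; ∃; _×_; _,_; proj₁; proj₂)
open import Data.Product.Function.NonDependent.Propositional using (_×-↔_)
open import Data.Product.Properties using (,-injective) renaming (≡-dec to ≡-dec-×)
open import Data.Sum using (_⊎_; inj₁; inj₂)
open import Data.Vec as Vec using (Vec; []; _∷_; lookup; _++_)
open import Data.Vec.Properties
  using (lookup-++ˡ; lookup-++ʳ; ++-injectiveˡ; ++-injectiveʳ; tabulate∘lookup; tabulate-cong)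
  renaming (≡-dec to ≡-dec-Vec)
open import Function.Bundles using (_↔_; Inverse)
open import Function.Definitions using (Injective)
open import Function.Properties.Inverse using (↔-refl; ↔-trans)
open import Relation.Binary.PropositionalEquality
open import Relation.Nullary using (¬_; Dec)
open import Relation.Nullary.Decidable using (map′; _×-dec_; _⊎-dec_; _→-dec_; ¬?; toWitness)

opaque
  rot : ∀ {n} → ℕ → Fin (suc n) → Fin (suc n)
  rot {n} a x = fromℕ< (m%n<n (toℕ x + a) (suc n))

  toℕ-rot : ∀ {n} a (x : Fin (suc n)) → toℕ (rot a x) ≡ (toℕ x + a) % suc n
  toℕ-rot a x = toℕ-fromℕ< _

[m%n+k]%n≡[m+k]%n : ∀ m k n .{{_ : ℕ.NonZero n}} → (m % n + k) % n ≡ (m + k) % n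
[m%n+k]%n≡[m+k]%n m k n = begin
  (m % n + k) % n          ≡⟨ %-distribˡ-+ (m % n) k n ⟩
  (m % n % n + k % n) % n  ≡⟨ cong (λ z → (z + k % n) % n) (m%n%n≡m%n m n) ⟩
  (m % n + k % n) % n      ≡⟨ %-distribˡ-+ m k n ⟨
  (m + k) % n              ∎
  where open ≡-Reasoning

rot-cong : ∀ {n a b} (x : Fin (suc n)) → a ≡ b → rot a x ≡ rot b x
rot-cong x refl = refl

rot-rot : ∀ {n} a b (x : Fin (suc n)) → rot a (rot b x) ≡ rot (b + a) x
rot-rot {n} a b x = toℕ-injective (begin
  toℕ (rot a (rot b x))               ≡⟨ toℕ-rot a (rot b x) ⟩
  (toℕ (rot b x) + a) % suc n         ≡⟨ cong (λ z → (z + a) % suc n) (toℕ-rot b x) ⟩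
  ((toℕ x + b) % suc n + a) % suc n   ≡⟨ [m%n+k]%n≡[m+k]%n (toℕ x + b) a (suc n) ⟩
  (toℕ x + b + a) % suc n             ≡⟨ cong (_% suc n) (+-assoc (toℕ x) b a) ⟩
  (toℕ x + (b + a)) % suc n           ≡⟨ toℕ-rot (b + a) x ⟨
  toℕ (rot (b + a) x)                 ∎)
  where open ≡-Reasoning

rot-comm : ∀ {n} a b (x : Fin (suc n)) → rot a (rot b x) ≡ rot b (rot a x)
rot-comm a b x = trans (rot-rot a b x) (trans (rot-cong x (+-comm b a)) (sym (rot-rot b a x)))

rot-+kN : ∀ {n} a k (x : Fin (suc n)) → rot (a + k * suc n) x ≡ rot a x
rot-+kN {n} a k x = toℕ-injective (begin
  toℕ (rot (a + k * suc n) x)          ≡⟨ toℕ-rot _ x ⟩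
  (toℕ x + (a + k * suc n)) % suc n    ≡⟨ cong (_% suc n) (+-assoc (toℕ x) a (k * suc n)) ⟨
  (toℕ x + a + k * suc n) % suc n      ≡⟨ [m+kn]%n≡m%n (toℕ x + a) k (suc n) ⟩
  (toℕ x + a) % suc n                  ≡⟨ toℕ-rot a x ⟨
  toℕ (rot a x)                        ∎)
  where open ≡-Reasoning

rot-zero : ∀ {n} (x : Fin (suc n)) → rot 0 x ≡ x
rot-zero {n} x = toℕ-injective (begin
  toℕ (rot 0 x)        ≡⟨ toℕ-rot 0 x ⟩
  (toℕ x + 0) % suc n  ≡⟨ cong (_% suc n) (+-identityʳ (toℕ x)) ⟩
  toℕ x % suc n        ≡⟨ m<n⇒m%n≡m (toℕ<n x) ⟩
  toℕ x                ∎)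
  where open ≡-Reasoning

rot-kN : ∀ {n} k (x : Fin (suc n)) → rot (k * suc n) x ≡ x
rot-kN k x = trans (rot-+kN 0 k x) (rot-zero x)

rot-N : ∀ {n} (x : Fin (suc n)) → rot (suc n) x ≡ x
rot-N {n} x = trans (rot-cong x (sym (*-identityˡ (suc n)))) (rot-kN 1 x)

unrot : ∀ {n} → ℕ → Fin (suc n) → Fin (suc n)
unrot {n} a = rot (a * n)

rot-unrot : ∀ {n} a (x : Fin (suc n)) → rot a (unrot a x) ≡ x
rot-unrot {n} a x = begin
  rot a (rot (a * n) x)  ≡⟨ rot-rot a (a * n) x ⟩
  rot (a * n + a) x      ≡⟨ rot-cong x (trans (+-comm (a * n) a) (sym (*-suc a n))) ⟩
  rot (a * suc n) x      ≡⟨ rot-kN a x ⟩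
  x                      ∎
  where open ≡-Reasoning

unrot-rot : ∀ {n} a (x : Fin (suc n)) → unrot a (rot a x) ≡ x
unrot-rot {n} a x = begin
  rot (a * n) (rot a x)  ≡⟨ rot-rot (a * n) a x ⟩
  rot (a + a * n) x      ≡⟨ rot-cong x (sym (*-suc a n)) ⟩
  rot (a * suc n) x      ≡⟨ rot-kN a x ⟩
  x                      ∎
  where open ≡-Reasoning

rot-injective : ∀ {n} a → Injective _≡_ _≡_ (rot {n} a)
rot-injective a {x} {y} eq = trans (sym (unrot-rot a x)) (trans (cong (unrot a) eq) (unrot-rot a y))

rot-cancelʳ : ∀ {n} a b (x : Fin (suc n)) → rot a x ≡ rot b x → a % suc n ≡ b % suc n
rot-cancelʳ {n} a b x eq = begin
  a % suc n                         ≡⟨ toℕ-rot a fz ⟨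
  toℕ (rot a fz)                    ≡⟨ cong toℕ (rot-zero≡unrot-rot a) ⟩
  toℕ (unrot (toℕ x) (rot a x))     ≡⟨ cong (λ z → toℕ (unrot (toℕ x) z)) eq ⟩
  toℕ (unrot (toℕ x) (rot b x))     ≡⟨ cong toℕ (rot-zero≡unrot-rot b) ⟨
  toℕ (rot b fz)                    ≡⟨ toℕ-rot b fz ⟩
  b % suc n                         ∎
  where
  open ≡-Reasoning
  x≡rot-zero : rot (toℕ x) fz ≡ x
  x≡rot-zero = toℕ-injective (trans (toℕ-rot (toℕ x) fz) (m<n⇒m%n≡m (toℕ<n x)))
  rot-zero≡unrot-rot : ∀ a → rot a fz ≡ unrot (toℕ x) (rot a x)
  rot-zero≡unrot-rot a = begin
    rot a fz                                ≡⟨ unrot-rot (toℕ x) (rot a fz) ⟨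
    unrot (toℕ x) (rot (toℕ x) (rot a fz))  ≡⟨ cong (unrot (toℕ x)) (rot-comm (toℕ x) a fz) ⟩
    unrot (toℕ x) (rot a (rot (toℕ x) fz))  ≡⟨ cong (λ z → unrot (toℕ x) (rot a z)) x≡rot-zero ⟩
    unrot (toℕ x) (rot a x)                 ∎

rot-fixpoint-free : ∀ {n} a (x : Fin (suc n)) → 0 < a → a < suc n → rot a x ≢ x
rot-fixpoint-free a x 0<a a<N eq =
  <-irrefl (sym (trans (sym (m<n⇒m%n≡m a<N)) (rot-cancelʳ a 0 x (trans eq (sym (rot-zero x)))))) 0<a

false≢true : false ≢ true
false≢true ()

isZero : ∀ {n} → Fin (suc n) → Bool
isZero fz     = true
isZero (fs _) = false

opaque
  isLast : ∀ {n} → Fin (suc n) → Bool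
  isLast {n} x = toℕ x ≡ᵇ n

  isLast⇒≡fromℕ : ∀ {n} (x : Fin (suc n)) → isLast x ≡ true → x ≡ fromℕ n
  isLast⇒≡fromℕ {n} x eq =
    toℕ-injective (trans (≡ᵇ⇒≡ (toℕ x) n (subst T (sym eq) _)) (sym (toℕ-fromℕ n)))

  toℕ≡⇒isLast : ∀ {n} (x : Fin (suc n)) → toℕ x ≡ n → isLast x ≡ true
  toℕ≡⇒isLast {n} x eq = trans (cong (_≡ᵇ n) eq) (≡ᵇ-refl n)
    where
    ≡ᵇ-refl : ∀ n → (n ≡ᵇ n) ≡ true
    ≡ᵇ-refl zero    = refl
    ≡ᵇ-refl (suc n) = ≡ᵇ-refl n

isLast-fromℕ : ∀ n → isLast (fromℕ n) ≡ true
isLast-fromℕ n = toℕ≡⇒isLast (fromℕ n) (toℕ-fromℕ n)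

¬isLast⇒< : ∀ {n} (x : Fin (suc n)) → isLast x ≡ false → toℕ x < n
¬isLast⇒< {n} x eq with m≤n⇒m<n∨m≡n (ℕ.s≤s⁻¹ (toℕ<n x))
... | inj₁ lt = lt
... | inj₂ e  with () ← trans (sym (toℕ≡⇒isLast x e)) eq

<⇒¬isLast : ∀ {n} (x : Fin (suc n)) → toℕ x < n → isLast x ≡ false
<⇒¬isLast {n} x lt with isLast x in eq
... | false = refl
... | true  = ⊥-elim (<-irrefl (trans (cong toℕ (isLast⇒≡fromℕ x eq)) (toℕ-fromℕ n)) lt)

isZero⇒≡zero : ∀ {n} (x : Fin (suc n)) → isZero x ≡ true → x ≡ fz
isZero⇒≡zero fz _ = refl

toℕ-rot1 : ∀ {n} (x : Fin (suc n)) → toℕ x < n → toℕ (rot 1 x) ≡ suc (toℕ x)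
toℕ-rot1 {n} x lt =
  trans (toℕ-rot 1 x) (trans (cong (_% suc n) (+-comm (toℕ x) 1)) (m<n⇒m%n≡m (s≤s lt)))

rot1-fromℕ : ∀ {n} → rot 1 (fromℕ n) ≡ fz
rot1-fromℕ {n} = toℕ-injective (begin
  toℕ (rot 1 (fromℕ n))        ≡⟨ toℕ-rot 1 (fromℕ n) ⟩
  (toℕ (fromℕ n) + 1) % suc n  ≡⟨ cong (λ z → (z + 1) % suc n) (toℕ-fromℕ n) ⟩
  (n + 1) % suc n              ≡⟨ cong (_% suc n) (+-comm n 1) ⟩
  suc n % suc n                ≡⟨ n%n≡0 (suc n) ⟩
  0                            ∎)
  where open ≡-Reasoning

rotn-zero : ∀ {n} → rot n (fz {n}) ≡ fromℕ n
rotn-zero {n} = toℕ-injective (trans (toℕ-rot n fz) (trans (m<n⇒m%n≡m (n<1+n n)) (sym (toℕ-fromℕ n))))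

rotn-rot1 : ∀ {n} (x : Fin (suc n)) → rot n (rot 1 x) ≡ x
rotn-rot1 {n} x = trans (rot-rot n 1 x) (rot-N x)

rot1-rotn : ∀ {n} (x : Fin (suc n)) → rot 1 (rot n x) ≡ x
rot1-rotn {n} x = trans (rot-rot 1 n x) (trans (rot-cong x (+-comm n 1)) (rot-N x))

isZero-rot1 : ∀ {n} (x : Fin (suc n)) → isZero (rot 1 x) ≡ isLast x
isZero-rot1 {n} x with isLast x in eq
... | true rewrite isLast⇒≡fromℕ x eq | rot1-fromℕ {n} = refl
... | false with rot 1 x | toℕ-rot1 x (¬isLast⇒< x eq)
...   | fs _ | _ = refl

isLast-rotn : ∀ {n} (x : Fin (suc n)) → isLast (rot n x) ≡ isZero x
isLast-rotn {n} fz = trans (cong isLast (rotn-zero {n})) (isLast-fromℕ n)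
isLast-rotn {n} (fs x) with isLast (rot n (fs x)) in eq
... | false = refl
... | true with () ← trans (sym (rot1-rotn (fs x))) (trans (cong (rot 1) (isLast⇒≡fromℕ _ eq)) rot1-fromℕ)

opposite-fromℕ : ∀ {n} → opposite (fromℕ n) ≡ fz
opposite-fromℕ {n} = toℕ-injective (trans (opposite-prop (fromℕ n)) (trans (cong (n ∸_) (toℕ-fromℕ n)) (n∸n≡0 n)))

opposite-injective : ∀ {n} → Injective _≡_ _≡_ (opposite {n})
opposite-injective {x = x} {y} eq =
  trans (sym (opposite-involutive x)) (trans (cong opposite eq) (opposite-involutive y))

isLast-opposite : ∀ {n} (x : Fin (suc n)) → isLast (opposite x) ≡ isZero x
isLast-opposite {n} fz = isLast-fromℕ n
isLast-opposite {suc n} (fs x) =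
  <⇒¬isLast (opposite (fs x)) (subst (_< suc n) (sym (opposite-prop (fs x))) (s≤s (m∸n≤m n (toℕ x))))

isZero-opposite : ∀ {n} (x : Fin (suc n)) → isZero (opposite x) ≡ isLast x
isZero-opposite x = trans (sym (isLast-opposite (opposite x))) (cong isLast (opposite-involutive x))

opposite-rot1 : ∀ {n} (x : Fin (suc n)) → opposite (rot 1 x) ≡ rot n (opposite x)
opposite-rot1 {n} x with isLast x in eq
... | true rewrite isLast⇒≡fromℕ x eq | rot1-fromℕ {n} | opposite-fromℕ {n} = sym (rotn-zero {n})
... | false = toℕ-injective (begin
  toℕ (opposite (rot 1 x))           ≡⟨ opposite-prop (rot 1 x) ⟩
  n ∸ toℕ (rot 1 x)                  ≡⟨ cong (n ∸_) (toℕ-rot1 x x<n) ⟩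
  n ∸ suc (toℕ x)                    ≡⟨ m<n⇒m%n≡m (s≤s (m∸n≤m n (suc (toℕ x)))) ⟨
  (n ∸ suc (toℕ x)) % suc n          ≡⟨ [m+n]%n≡m%n (n ∸ suc (toℕ x)) (suc n) ⟨
  (n ∸ suc (toℕ x) + suc n) % suc n  ≡⟨ cong (_% suc n) (+-suc (n ∸ suc (toℕ x)) n) ⟩
  (suc (n ∸ suc (toℕ x)) + n) % suc n ≡⟨ cong (λ z → (z + n) % suc n) (+-∸-assoc 1 x<n) ⟨
  (n ∸ toℕ x + n) % suc n            ≡⟨ cong (λ z → (z + n) % suc n) (opposite-prop x) ⟨
  (toℕ (opposite x) + n) % suc n     ≡⟨ toℕ-rot n (opposite x) ⟨
  toℕ (rot n (opposite x))           ∎)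
  where
  open ≡-Reasoning
  x<n : toℕ x < n
  x<n = ¬isLast⇒< x eq

Pos : ℕ → Set
Pos n = Fin (suc n) × Fin (suc n)

succ : ∀ {n} → Pos n → Pos n
succ (j , t) = (if isLast t then rot 1 j else j) , rot 1 t

pred : ∀ {n} → Pos n → Pos n
pred {n} (j , t) = (if isZero t then rot n j else j) , rot n t

pred-succ : ∀ {n} (p : Pos n) → pred (succ p) ≡ p
pred-succ {n} (j , t) rewrite isZero-rot1 t | rotn-rot1 t with isLast t
... | true  = cong (_, t) (rotn-rot1 j)
... | false = refl

succ-pred : ∀ {n} (p : Pos n) → succ (pred p) ≡ p
succ-pred {n} (j , t) rewrite isLast-rotn t | rot1-rotn t with isZero t
... | true  = cong (_, t) (rot1-rotn j)
... | false = refl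

succ-injective : ∀ {n} → Injective _≡_ _≡_ (succ {n})
succ-injective {x = p} {q} eq = trans (sym (pred-succ p)) (trans (cong pred eq) (pred-succ q))

succ-¬isLast : ∀ {n} j (t : Fin (suc n)) → isLast t ≡ false → succ (j , t) ≡ (j , rot 1 t)
succ-¬isLast j t eq rewrite eq = refl

succ-fromℕ : ∀ {n} (j : Fin (suc n)) → succ (j , fromℕ n) ≡ (rot 1 j , fz)
succ-fromℕ {n} j rewrite isLast-fromℕ n | rot1-fromℕ {n} = refl

rev : ∀ {n} → Pos n → Pos n
rev (j , t) = opposite j , opposite t

rev-involutive : ∀ {n} (p : Pos n) → rev (rev p) ≡ p
rev-involutive (j , t) = cong₂ _,_ (opposite-involutive j) (opposite-involutive t)

rev-injective : ∀ {n} → Injective _≡_ _≡_ (rev {n})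
rev-injective {x = p} {q} eq = trans (sym (rev-involutive p)) (trans (cong rev eq) (rev-involutive q))

rev-succ : ∀ {n} (p : Pos n) → rev (succ p) ≡ pred (rev p)
rev-succ {n} (j , t) rewrite isZero-opposite t | opposite-rot1 t with isLast t
... | true  = cong (_, rot n (opposite t)) (opposite-rot1 j)
... | false = refl

unhalve : ∀ {n} → Bool × Fin (suc n) → Fin (suc n + suc n)
unhalve {n} (false , u) = u ↑ˡ suc n
unhalve {n} (true  , u) = suc n ↑ʳ u

opaque
  halve : ∀ {n} → Fin (suc n + suc n) → Bool × Fin (suc n)
  halve {n} x with Fin.splitAt (suc n) x
  ... | inj₁ u = false , u
  ... | inj₂ u = true , u

  halve-unhalve : ∀ {n} (p : Bool × Fin (suc n)) → halve (unhalve p) ≡ p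
  halve-unhalve {n} (false , u) rewrite splitAt-↑ˡ (suc n) u (suc n) = refl
  halve-unhalve {n} (true  , u) rewrite splitAt-↑ʳ (suc n) (suc n) u = refl

  unhalve-halve : ∀ {n} (x : Fin (suc n + suc n)) → unhalve (halve x) ≡ x
  unhalve-halve {n} x with Fin.splitAt (suc n) x in eq
  ... | inj₁ u = trans (sym (cong (Fin.join (suc n) (suc n)) eq)) (join-splitAt (suc n) (suc n) x)
  ... | inj₂ u = trans (sym (cong (Fin.join (suc n) (suc n)) eq)) (join-splitAt (suc n) (suc n) x)

halve-injective : ∀ {n} → Injective _≡_ _≡_ (halve {n})
halve-injective {x = x} {y} eq = trans (sym (unhalve-halve x)) (trans (cong unhalve eq) (unhalve-halve y))

offset : ℕ → Bool → ℕ
offset n b = if b then suc n else 0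

toℕ-unhalve : ∀ {n} b (u : Fin (suc n)) → toℕ (unhalve (b , u)) ≡ offset n b + toℕ u
toℕ-unhalve {n} false u = toℕ-↑ˡ u (suc n)
toℕ-unhalve {n} true  u = toℕ-↑ʳ (suc n) u

unhalve-fromℕ : ∀ {n} → unhalve (true , fromℕ n) ≡ fromℕ (n + suc n)
unhalve-fromℕ {n} = toℕ-injective (begin
  toℕ (unhalve (true , fromℕ n))  ≡⟨ toℕ-unhalve true (fromℕ n) ⟩
  suc n + toℕ (fromℕ n)           ≡⟨ cong (suc n +_) (toℕ-fromℕ n) ⟩
  suc n + n                       ≡⟨ +-suc n n ⟨
  n + suc n                       ≡⟨ toℕ-fromℕ (n + suc n) ⟨
  toℕ (fromℕ (n + suc n))         ∎)
  where open ≡-Reasoning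

rot1-unhalve : ∀ {n} b (u : Fin (suc n)) → rot 1 (unhalve (b , u)) ≡ unhalve (b xor isLast u , rot 1 u)
rot1-unhalve {n} b u with isLast u in eq
... | false rewrite xor-identityʳ b = toℕ-injective (begin
  toℕ (rot 1 (unhalve (b , u)))    ≡⟨ toℕ-rot1 (unhalve (b , u)) inner ⟩
  suc (toℕ (unhalve (b , u)))      ≡⟨ cong suc (toℕ-unhalve b u) ⟩
  suc (offset n b + toℕ u)         ≡⟨ +-suc (offset n b) (toℕ u) ⟨
  offset n b + suc (toℕ u)         ≡⟨ cong (offset n b +_) (toℕ-rot1 u u<n) ⟨
  offset n b + toℕ (rot 1 u)       ≡⟨ toℕ-unhalve b (rot 1 u) ⟨
  toℕ (unhalve (b , rot 1 u))      ∎)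
  where
  open ≡-Reasoning
  u<n : toℕ u < n
  u<n = ¬isLast⇒< u eq
  offset≤ : ∀ b → offset n b ≤ suc n
  offset≤ false = z≤n
  offset≤ true  = ≤-refl
  inner : toℕ (unhalve (b , u)) < n + suc n
  inner = subst₂ _<_ (sym (toℕ-unhalve b u)) (+-comm (suc n) n) (+-mono-≤-< (offset≤ b) u<n)
... | true rewrite isLast⇒≡fromℕ u eq | rot1-fromℕ {n} with b
...   | false = toℕ-injective (begin
  toℕ (rot 1 (fromℕ n ↑ˡ suc n))  ≡⟨ toℕ-rot1 (fromℕ n ↑ˡ suc n) (subst (_< n + suc n) (sym n≡) (m<m+n n (s≤s z≤n))) ⟩
  suc (toℕ (fromℕ n ↑ˡ suc n))    ≡⟨ cong suc n≡ ⟩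
  suc n                           ≡⟨ +-identityʳ (suc n) ⟨
  suc n + 0                       ≡⟨ toℕ-↑ʳ (suc n) (fz {n}) ⟨
  toℕ (suc n ↑ʳ fz {n})            ∎)
  where
  open ≡-Reasoning
  n≡ : toℕ (fromℕ n ↑ˡ suc n) ≡ n
  n≡ = trans (toℕ-↑ˡ (fromℕ n) (suc n)) (toℕ-fromℕ n)
...   | true = trans (cong (rot 1) unhalve-fromℕ) rot1-fromℕ

isLast-unhalve : ∀ {n} b (u : Fin (suc n)) → isLast (unhalve (b , u)) ≡ b ∧ isLast u
isLast-unhalve {n} false u =
  <⇒¬isLast _ (subst (_< n + suc n) (sym (toℕ-↑ˡ u (suc n))) (≤-trans (toℕ<n u) (m≤n+m (suc n) n)))
isLast-unhalve {n} true u with isLast u in eq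
... | true rewrite isLast⇒≡fromℕ u eq = trans (cong isLast unhalve-fromℕ) (isLast-fromℕ (n + suc n))
... | false = <⇒¬isLast _ (subst₂ _<_ (sym (toℕ-↑ʳ (suc n) u)) (sym (+-suc n n)) (+-monoʳ-< (suc n) (¬isLast⇒< u eq)))

lookup-extensionality : ∀ {A : Set} {n} (xs ys : Vec A n) → (∀ i → lookup xs i ≡ lookup ys i) → xs ≡ ys
lookup-extensionality xs ys eq = trans (sym (tabulate∘lookup xs)) (trans (tabulate-cong eq) (tabulate∘lookup ys))

Adjacent-sym : ∀ {n} {u v : Vertex n} → Adjacent u v → Adjacent v u
Adjacent-sym (i , ne , f) = i , (λ e → ne (sym e)) , (λ j j≢i → sym (f j j≢i))

Adjacent-irrefl : ∀ {n} {u : Vertex n} → ¬ Adjacent u u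
Adjacent-irrefl (i , ne , _) = ne refl

↑ˡ≢↑ʳ : ∀ {m n} (i : Fin m) (j : Fin n) → i ↑ˡ n ≢ m ↑ʳ j
↑ˡ≢↑ʳ {m} {n} i j eq =
  <⇒≱ (toℕ<n i) (subst (m ≤_) (trans (sym (toℕ-↑ʳ m j)) (trans (cong toℕ (sym eq)) (toℕ-↑ˡ i n))) (m≤m+n m (toℕ j)))

Adjacent-++ˡ : ∀ {a b} {x x′ : Vertex a} (y : Vertex b) → Adjacent x x′ → Adjacent (x ++ y) (x′ ++ y)
Adjacent-++ˡ {a} {b} {x} {x′} y (i , ne , f) = i ↑ˡ b , ne′ , g
  where
  ne′ : lookup (x ++ y) (i ↑ˡ b) ≢ lookup (x′ ++ y) (i ↑ˡ b)
  ne′ e = ne (trans (sym (lookup-++ˡ x y i)) (trans e (lookup-++ˡ x′ y i)))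
  g : ∀ j → j ≢ i ↑ˡ b → lookup (x ++ y) j ≡ lookup (x′ ++ y) j
  g j j≢ with Fin.splitAt a j in eq
  ... | inj₁ j′ rewrite sym (splitAt⁻¹-↑ˡ eq) =
    trans (lookup-++ˡ x y j′) (trans (f j′ (λ e → j≢ (cong (_↑ˡ b) e))) (sym (lookup-++ˡ x′ y j′)))
  ... | inj₂ j′ rewrite sym (splitAt⁻¹-↑ʳ eq) = trans (lookup-++ʳ x y j′) (sym (lookup-++ʳ x′ y j′))

Adjacent-++ʳ : ∀ {a b} (x : Vertex a) {y y′ : Vertex b} → Adjacent y y′ → Adjacent (x ++ y) (x ++ y′)
Adjacent-++ʳ {a} {b} x {y} {y′} (i , ne , f) = a ↑ʳ i , ne′ , g
  where
  ne′ : lookup (x ++ y) (a ↑ʳ i) ≢ lookup (x ++ y′) (a ↑ʳ i)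
  ne′ e = ne (trans (sym (lookup-++ʳ x y i)) (trans e (lookup-++ʳ x y′ i)))
  g : ∀ j → j ≢ a ↑ʳ i → lookup (x ++ y) j ≡ lookup (x ++ y′) j
  g j j≢ with Fin.splitAt a j in eq
  ... | inj₁ j′ rewrite sym (splitAt⁻¹-↑ˡ eq) = trans (lookup-++ˡ x y j′) (sym (lookup-++ˡ x y′ j′))
  ... | inj₂ j′ rewrite sym (splitAt⁻¹-↑ʳ eq) =
    trans (lookup-++ʳ x y j′) (trans (f j′ (λ e → j≢ (cong (a ↑ʳ_) e))) (sym (lookup-++ʳ x y′ j′)))

Adjacent-++⁻ : ∀ {a b} (x x′ : Vertex a) (y y′ : Vertex b) → Adjacent (x ++ y) (x′ ++ y′) →
               (Adjacent x x′ × y ≡ y′) ⊎ (x ≡ x′ × Adjacent y y′)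
Adjacent-++⁻ {a} {b} x x′ y y′ (i , ne , f) with Fin.splitAt a i in eq
... | inj₁ i′ rewrite sym (splitAt⁻¹-↑ˡ eq) = inj₁ ((i′ , ne′ , g) , lookup-extensionality y y′ h)
  where
  ne′ : lookup x i′ ≢ lookup x′ i′
  ne′ e = ne (trans (lookup-++ˡ x y i′) (trans e (sym (lookup-++ˡ x′ y′ i′))))
  g : ∀ j → j ≢ i′ → lookup x j ≡ lookup x′ j
  g j j≢ = trans (sym (lookup-++ˡ x y j)) (trans (f (j ↑ˡ b) (λ e → j≢ (↑ˡ-injective b j i′ e))) (lookup-++ˡ x′ y′ j))
  h : ∀ j → lookup y j ≡ lookup y′ j
  h j = trans (sym (lookup-++ʳ x y j)) (trans (f (a ↑ʳ j) (λ e → ↑ˡ≢↑ʳ i′ j (sym e))) (lookup-++ʳ x′ y′ j))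
... | inj₂ i′ rewrite sym (splitAt⁻¹-↑ʳ eq) = inj₂ (lookup-extensionality x x′ h , (i′ , ne′ , g))
  where
  ne′ : lookup y i′ ≢ lookup y′ i′
  ne′ e = ne (trans (lookup-++ʳ x y i′) (trans e (sym (lookup-++ʳ x′ y′ i′))))
  g : ∀ j → j ≢ i′ → lookup y j ≡ lookup y′ j
  g j j≢ = trans (sym (lookup-++ʳ x y j)) (trans (f (a ↑ʳ j) (λ e → j≢ (↑ʳ-injective a j i′ e))) (lookup-++ʳ x′ y′ j))
  h : ∀ j → lookup x j ≡ lookup x′ j
  h j = trans (sym (lookup-++ˡ x y j)) (trans (f (j ↑ˡ b) (λ e → ↑ˡ≢↑ʳ j i′ e)) (lookup-++ˡ x′ y′ j))

SameEdge-swap : ∀ {n} (u v : Vertex n) → SameEdge u v v u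
SameEdge-swap u v = inj₂ (refl , refl)

SameEdge-sym : ∀ {n} {u v a b : Vertex n} → SameEdge u v a b → SameEdge a b u v
SameEdge-sym (inj₁ (refl , refl)) = inj₁ (refl , refl)
SameEdge-sym (inj₂ (refl , refl)) = inj₂ (refl , refl)

SameEdge-trans : ∀ {n} {u v a b x y : Vertex n} → SameEdge u v a b → SameEdge a b x y → SameEdge u v x y
SameEdge-trans (inj₁ (refl , refl)) s                    = s
SameEdge-trans (inj₂ (refl , refl)) (inj₁ (refl , refl)) = inj₂ (refl , refl)
SameEdge-trans (inj₂ (refl , refl)) (inj₂ (refl , refl)) = inj₁ (refl , refl)

SameEdge-flip : ∀ {n} {u v a b : Vertex n} → SameEdge u v a b → SameEdge u v b a
SameEdge-flip (inj₁ (p , q)) = inj₂ (p , q)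
SameEdge-flip (inj₂ (p , q)) = inj₁ (p , q)

SameEdge-++ˡ⁻ : ∀ {a b} {x x′ z z′ : Vertex a} {y y′ : Vertex b} →
                SameEdge (x ++ y) (x′ ++ y) (z ++ y′) (z′ ++ y′) → SameEdge x x′ z z′ × y ≡ y′
SameEdge-++ˡ⁻ {x = x} {x′} {z} {z′} (inj₁ (p , q)) = inj₁ (++-injectiveˡ x z p , ++-injectiveˡ x′ z′ q) , ++-injectiveʳ x z p
SameEdge-++ˡ⁻ {x = x} {x′} {z} {z′} (inj₂ (p , q)) = inj₂ (++-injectiveˡ x z′ p , ++-injectiveˡ x′ z q) , ++-injectiveʳ x z′ p

SameEdge-++ʳ⁻ : ∀ {a b} {x x′ : Vertex a} {y y′ z z′ : Vertex b} →
                SameEdge (x ++ y) (x ++ y′) (x′ ++ z) (x′ ++ z′) → x ≡ x′ × SameEdge y y′ z z′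
SameEdge-++ʳ⁻ {x = x} {x′} (inj₁ (p , q)) = ++-injectiveˡ x x′ p , inj₁ (++-injectiveʳ x x′ p , ++-injectiveʳ x x′ q)
SameEdge-++ʳ⁻ {x = x} {x′} (inj₂ (p , q)) = ++-injectiveˡ x x′ p , inj₂ (++-injectiveʳ x x′ p , ++-injectiveʳ x x′ q)

SameEdge-++ˡʳ : ∀ {a b} {x x′ z : Vertex a} {y w w′ : Vertex b} →
                Adjacent x x′ → ¬ SameEdge (x ++ y) (x′ ++ y) (z ++ w) (z ++ w′)
SameEdge-++ˡʳ {x = x} {x′} {z} adj (inj₁ (p , q)) =
  Adjacent-irrefl {u = x} (subst (Adjacent x) (trans (++-injectiveˡ x′ z q) (sym (++-injectiveˡ x z p))) adj)
SameEdge-++ˡʳ {x = x} {x′} {z} adj (inj₂ (p , q)) =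
  Adjacent-irrefl {u = x} (subst (Adjacent x) (trans (++-injectiveˡ x′ z q) (sym (++-injectiveˡ x z p))) adj)

SameEdge-++ˡ : ∀ {a b} {u v x x′ : Vertex a} (y : Vertex b) → SameEdge u v x x′ → SameEdge (u ++ y) (v ++ y) (x ++ y) (x′ ++ y)
SameEdge-++ˡ y (inj₁ (refl , refl)) = inj₁ (refl , refl)
SameEdge-++ˡ y (inj₂ (refl , refl)) = inj₂ (refl , refl)

SameEdge-++ʳ : ∀ {a b} (x : Vertex a) {u v y y′ : Vertex b} → SameEdge u v y y′ → SameEdge (x ++ u) (x ++ v) (x ++ y) (x ++ y′)
SameEdge-++ʳ x (inj₁ (refl , refl)) = inj₁ (refl , refl)
SameEdge-++ʳ x (inj₂ (refl , refl)) = inj₂ (refl , refl)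

segmentEnd : ∀ {n} → Bool → Fin (suc n)
segmentEnd false = fz
segmentEnd true  = fromℕ _

opposite-segmentEnd : ∀ {n} b → opposite (segmentEnd {n} b) ≡ segmentEnd (not b)
opposite-segmentEnd false = refl
opposite-segmentEnd true  = opposite-fromℕ

-- Segment j of cycle i consists of the vertices `cycle i (j , t)`; `succ` runs along the cycle.
record SegmentedDecomposition (d n : ℕ) (I : Set) : Set where
  field
    cycle           : I → Pos n → Vertex d
    cycle-injective : ∀ i {p q} → cycle i p ≡ cycle i q → p ≡ q
    cycle-adjacent  : ∀ i p → Adjacent (cycle i p) (cycle i (succ p))
    edge-cover      : ∀ u v → Adjacent u v → Σ (I × Pos n) λ (i , p) → SameEdge u v (cycle i p) (cycle i (succ p))
    edge-unique     : ∀ {i p i′ p′} → SameEdge (cycle i p) (cycle i (succ p)) (cycle i′ p′) (cycle i′ (succ p′)) →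
                      i ≡ i′ × p ≡ p′
    end-cover       : ∀ v → Σ (I × Fin (suc n) × Bool) λ (i , j , e) → v ≡ cycle i (j , segmentEnd e)
    end-unique      : ∀ {i j e i′ j′ e′} → cycle i (j , segmentEnd e) ≡ cycle i′ (j′ , segmentEnd e′) →
                      i ≡ i′ × j ≡ j′ × e ≡ e′

module _ {d n} {I : Set} (D : SegmentedDecomposition d n I) where
  open SegmentedDecomposition D

  private
    cycleʳ : I → Pos n → Vertex d
    cycleʳ i p = cycle i (rev p)

    cycleʳ-succ : ∀ i p → cycleʳ i (succ p) ≡ cycle i (pred (rev p))
    cycleʳ-succ i p = cong (cycle i) (rev-succ p)

  cycleʳ-segmentEnd : ∀ i j e → cycleʳ i (j , segmentEnd e) ≡ cycle i (opposite j , segmentEnd (not e))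
  cycleʳ-segmentEnd i j e = cong (λ z → cycle i (opposite j , z)) (opposite-segmentEnd e)

  reverse : SegmentedDecomposition d n I
  reverse = record
    { cycle           = cycleʳ
    ; cycle-injective = λ i e → rev-injective (cycle-injective i e)
    ; cycle-adjacent  = adjacent
    ; edge-cover      = cover
    ; edge-unique     = unique
    ; end-cover       = endCover
    ; end-unique      = endUnique
    }
    where
    adjacent : ∀ i p → Adjacent (cycleʳ i p) (cycleʳ i (succ p))
    adjacent i p rewrite cycleʳ-succ i p =
      Adjacent-sym {u = cycle i (pred (rev p))} {v = cycle i (rev p)} (subst (λ z → Adjacent (cycle i (pred (rev p))) (cycle i z))
                                             (succ-pred (rev p)) (cycle-adjacent i (pred (rev p))))

    cover : ∀ u v → Adjacent u v → Σ (I × Pos n) λ (i , p) → SameEdge u v (cycleʳ i p) (cycleʳ i (succ p))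
    cover u v a with edge-cover u v a
    ... | (i , q) , s = (i , rev (succ q)) , SameEdge-trans s (subst₂ (SameEdge (cycle i q) (cycle i (succ q)))
            (cong (cycle i) (sym (rev-involutive (succ q))))
            (sym (begin
              cycleʳ i (succ (rev (succ q)))       ≡⟨ cycleʳ-succ i (rev (succ q)) ⟩
              cycle i (pred (rev (rev (succ q))))  ≡⟨ cong (λ z → cycle i (pred z)) (rev-involutive (succ q)) ⟩
              cycle i (pred (succ q))              ≡⟨ cong (cycle i) (pred-succ q) ⟩
              cycle i q                            ∎))
            (SameEdge-swap (cycle i q) (cycle i (succ q))))
      where open ≡-Reasoning

    unique : ∀ {i p i′ p′} → SameEdge (cycleʳ i p) (cycleʳ i (succ p)) (cycleʳ i′ p′) (cycleʳ i′ (succ p′)) → i ≡ i′ × p ≡ p′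
    unique {i} {p} {i′} {p′} s with edge-unique {i} {pred (rev p)} {i′} {pred (rev p′)} s′
      where
      s′ : SameEdge (cycle i (pred (rev p))) (cycle i (succ (pred (rev p))))
                    (cycle i′ (pred (rev p′))) (cycle i′ (succ (pred (rev p′))))
      s′ rewrite succ-pred (rev p) | succ-pred (rev p′) | sym (rev-succ p) | sym (rev-succ p′) =
        SameEdge-flip (SameEdge-sym (SameEdge-flip (SameEdge-sym s)))
    ... | refl , e = refl , rev-injective (trans (sym (succ-pred (rev p))) (trans (cong succ e) (succ-pred (rev p′))))

    endCover : ∀ v → Σ (I × Fin (suc n) × Bool) λ (i , j , e) → v ≡ cycleʳ i (j , segmentEnd e)
    endCover v with end-cover v
    ... | (i , j , e) , eq = (i , opposite j , not e) , trans eq (sym (trans (cycleʳ-segmentEnd i (opposite j) (not e))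
             (cong₂ (λ a b → cycle i (a , segmentEnd b)) (opposite-involutive j) (not-involutive e))))

    endUnique : ∀ {i j e i′ j′ e′} → cycleʳ i (j , segmentEnd e) ≡ cycleʳ i′ (j′ , segmentEnd e′) → i ≡ i′ × j ≡ j′ × e ≡ e′
    endUnique {i} {j} {e} {i′} {j′} {e′} eq
      with end-unique (trans (sym (cycleʳ-segmentEnd i j e)) (trans eq (cycleʳ-segmentEnd i′ j′ e′)))
    ... | refl , oj , ne = refl , opposite-injective oj , trans (sym (not-involutive e)) (trans (cong not ne) (not-involutive e′))

odd : ℕ → ℕ
odd m = m + suc m

<⇒<ᵇ≡true : ∀ {m n} → m < n → (m <ᵇ n) ≡ true
<⇒<ᵇ≡true {m} {n} lt with m <ᵇ n in eq
... | true  = refl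
... | false = ⊥-elim (subst T eq (<⇒<ᵇ lt))

≤⇒<ᵇ≡false : ∀ {m n} → n ≤ m → (m <ᵇ n) ≡ false
≤⇒<ᵇ≡false {m} {n} le with m <ᵇ n in eq
... | false = refl
... | true  = ⊥-elim (<⇒≱ (<ᵇ⇒< m n (subst T (sym eq) _)) le)

-- In segment α of a doubled cycle the second coordinate rests at segment `row γ α = γ + Λ α`
-- and then moves by `step`: +1 in the first k of the N = 4k segments, +n ≡ -1 in the other 3k.
-- Hence Λ N ≡ k - 3k ≡ H (mod N), so the second half of the cycle, which starts from γ + H,
-- continues where the first half ends.
module Schedule (k′ : ℕ) where
  k h n H N : ℕ
  k = suc k′
  h = odd k′
  n = odd h
  H = suc h
  N = suc n

  forward : Fin N → Bool
  forward α = toℕ α <ᵇ k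

  step : Bool → ℕ
  step true  = 1
  step false = n

  Λ : ℕ → ℕ
  Λ zero    = 0
  Λ (suc a) = Λ a + step (a <ᵇ k)

  row : Fin N → Fin N → Fin N
  row γ α = rot (Λ (toℕ α)) γ

  nextRow : Fin N → Fin N → Fin N
  nextRow γ α = rot (step (forward α)) (row γ α)

  row-rot1 : ∀ γ α → isLast α ≡ false → row γ (rot 1 α) ≡ nextRow γ α
  row-rot1 γ α eq = trans (rot-cong γ (cong Λ (toℕ-rot1 α (¬isLast⇒< α eq)))) (sym (rot-rot _ (Λ (toℕ α)) γ))

  Λ-≤k : ∀ a → a ≤ k → Λ a ≡ a
  Λ-≤k zero    _  = refl
  Λ-≤k (suc a) le rewrite <⇒<ᵇ≡true {a} {k} le | Λ-≤k a (≤-trans (n≤1+n a) le) = +-comm a 1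

  Λ-k+ : ∀ b → Λ (k + b) ≡ k + b * n
  Λ-k+ zero    = trans (cong Λ (+-identityʳ k)) (trans (Λ-≤k k ≤-refl) (sym (+-identityʳ k)))
  Λ-k+ (suc b) = begin
    Λ (k + suc b)                     ≡⟨ cong Λ (+-suc k b) ⟩
    Λ (k + b) + step ((k + b) <ᵇ k)   ≡⟨ cong₂ _+_ (Λ-k+ b) (cong step (≤⇒<ᵇ≡false {k + b} {k} (m≤m+n k b))) ⟩
    k + b * n + n                     ≡⟨ trans (+-assoc k (b * n) n) (cong (k +_) (+-comm (b * n) n)) ⟩
    k + suc b * n                     ∎
    where open ≡-Reasoning

  Λ-N : Λ N ≡ H + (3 * k′ + 2) * N
  Λ-N = begin
    Λ N                        ≡⟨ cong Λ (N≡4k k′) ⟩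
    Λ (k + (k + (k + k)))      ≡⟨ Λ-k+ (k + (k + k)) ⟩
    k + (k + (k + k)) * n      ≡⟨ solve₂ k′ ⟩
    H + (3 * k′ + 2) * N       ∎
    where
    open ≡-Reasoning
    N≡4k : ∀ k′ → suc ((k′ + suc k′) + suc (k′ + suc k′)) ≡ suc k′ + (suc k′ + (suc k′ + suc k′))
    N≡4k = solve-∀
    solve₂ : ∀ k′ → suc k′ + (suc k′ + (suc k′ + suc k′)) * ((k′ + suc k′) + suc (k′ + suc k′))
                   ≡ suc (k′ + suc k′) + (3 * k′ + 2) * suc ((k′ + suc k′) + suc (k′ + suc k′))
    solve₂ = solve-∀

  nextRow-last : ∀ γ → nextRow γ (fromℕ n) ≡ rot H γ
  nextRow-last γ = begin
    rot (step (forward (fromℕ n))) (rot (Λ (toℕ (fromℕ n))) γ)  ≡⟨ cong (λ z → rot (step (z <ᵇ k)) (rot (Λ z) γ)) (toℕ-fromℕ n) ⟩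
    rot (step (n <ᵇ k)) (rot (Λ n) γ)                          ≡⟨ rot-rot _ (Λ n) γ ⟩
    rot (Λ N) γ                                                ≡⟨ rot-cong γ Λ-N ⟩
    rot (H + (3 * k′ + 2) * N) γ                               ≡⟨ rot-+kN H (3 * k′ + 2) γ ⟩
    rot H γ                                                    ∎
    where open ≡-Reasoning

  unrow : Fin N → Fin N → Fin N
  unrow λ′ α = unrot (Λ (toℕ α)) λ′

  unnextRow : Fin N → Fin N → Fin N
  unnextRow λ′ α = unrot (Λ (toℕ α)) (unrot (step (forward α)) λ′)

  row-unrow : ∀ λ′ α → row (unrow λ′ α) α ≡ λ′
  row-unrow λ′ α = rot-unrot (Λ (toℕ α)) λ′

  unrow-row : ∀ γ α → unrow (row γ α) α ≡ γ
  unrow-row γ α = unrot-rot (Λ (toℕ α)) γ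

  nextRow-unnextRow : ∀ λ′ α → nextRow (unnextRow λ′ α) α ≡ λ′
  nextRow-unnextRow λ′ α =
    trans (cong (rot (step (forward α))) (rot-unrot (Λ (toℕ α)) _)) (rot-unrot (step (forward α)) λ′)

  unnextRow-nextRow : ∀ γ α → unnextRow (nextRow γ α) α ≡ γ
  unnextRow-nextRow γ α =
    trans (cong (unrot (Λ (toℕ α))) (unrot-rot (step (forward α)) (row γ α))) (unrot-rot (Λ (toℕ α)) γ)

  row-rotH : ∀ γ α → row (rot H γ) α ≡ rot H (row γ α)
  row-rotH γ α = rot-comm (Λ (toℕ α)) H γ

  1≤h : 1 ≤ h
  1≤h = ≤-trans (s≤s z≤n) (m≤n+m (suc k′) k′)

  H<N : H < N
  H<N = s≤s (m≤n+m (suc h) h)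

  rotH-fixpoint-free : ∀ (x : Fin N) → rot H x ≢ x
  rotH-fixpoint-free x = rot-fixpoint-free H x (s≤s z≤n) H<N

  rot1∘rotH-fixpoint-free : ∀ (x : Fin N) → rot 1 (rot H x) ≢ x
  rot1∘rotH-fixpoint-free x eq = rot-fixpoint-free (H + 1) x (s≤s z≤n) H+1<N (trans (sym (rot-rot 1 H x)) eq)
    where
    H+1<N : H + 1 < N
    H+1<N = s≤s (≤-trans (s≤s (+-monoʳ-≤ h 1≤h)) (≤-reflexive (sym (+-suc h h))))

  rotn∘rotH-fixpoint-free : ∀ (x : Fin N) → rot n (rot H x) ≢ x
  rotn∘rotH-fixpoint-free x eq =
    rot-fixpoint-free h x 1≤h (≤-trans (n≤1+n (suc h)) H<N)
      (trans (sym (rot-+kN h 1 x)) (trans (rot-cong x h+N≡H+n) (trans (sym (rot-rot n H x)) eq)))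
    where
    h+N≡H+n : h + 1 * N ≡ H + n
    h+N≡H+n = trans (cong (h +_) (+-identityʳ N)) (+-suc h n)

  step-fixpoint-free : ∀ b (x : Fin N) → rot (step b) x ≢ x
  step-fixpoint-free true  x = rot-fixpoint-free 1 x (s≤s z≤n) (s≤s (≤-trans 1≤h (m≤m+n h (suc h))))
  step-fixpoint-free false x = rot-fixpoint-free n x (≤-trans 1≤h (m≤m+n h (suc h))) ≤-refl

  step∘rotH-fixpoint-free : ∀ b (x : Fin N) → rot (step b) (rot H x) ≢ x
  step∘rotH-fixpoint-free true  = rot1∘rotH-fixpoint-free
  step∘rotH-fixpoint-free false = rotn∘rotH-fixpoint-free

  rotH-unhalve : ∀ e (β : Fin H) → rot H (unhalve {h} (e , β)) ≡ unhalve (not e , β)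
  rotH-unhalve false β = toℕ-injective (begin
    toℕ (rot H (β ↑ˡ H))     ≡⟨ toℕ-rot H (β ↑ˡ H) ⟩
    (toℕ (β ↑ˡ H) + H) % N   ≡⟨ cong (λ z → (z + H) % N) (toℕ-↑ˡ β H) ⟩
    (toℕ β + H) % N          ≡⟨ m<n⇒m%n≡m (subst (_< N) (+-comm H (toℕ β)) (+-monoʳ-< H (toℕ<n β))) ⟩
    toℕ β + H                ≡⟨ +-comm (toℕ β) H ⟩
    H + toℕ β                ≡⟨ toℕ-↑ʳ H β ⟨
    toℕ (H ↑ʳ β)             ∎)
    where open ≡-Reasoning
  rotH-unhalve true β = toℕ-injective (begin
    toℕ (rot H (H ↑ʳ β))     ≡⟨ toℕ-rot H (H ↑ʳ β) ⟩
    (toℕ (H ↑ʳ β) + H) % N   ≡⟨ cong (λ z → (z + H) % N) (toℕ-↑ʳ H β) ⟩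
    (H + toℕ β + H) % N      ≡⟨ cong (_% N) (trans (+-comm (H + toℕ β) H) (sym (+-assoc H H (toℕ β)))) ⟩
    (H + H + toℕ β) % N      ≡⟨ cong (_% N) (+-comm N (toℕ β)) ⟩
    (toℕ β + N) % N          ≡⟨ [m+n]%n≡m%n (toℕ β) N ⟩
    toℕ β % N                ≡⟨ m<n⇒m%n≡m (≤-trans (toℕ<n β) (<⇒≤ H<N)) ⟩
    toℕ β                    ≡⟨ toℕ-↑ˡ β H ⟨
    toℕ (β ↑ˡ H)             ∎)
    where open ≡-Reasoning

module Product {d₁ d₂ : ℕ} {I₁ I₂ : Set} (k′ : ℕ)
               (D₁ : SegmentedDecomposition d₁ (odd (odd k′)) I₁)
               (D₂ : SegmentedDecomposition d₂ (odd (odd k′)) I₂) where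
  open Schedule k′
  open SegmentedDecomposition D₁ renaming
    ( cycle to C₁; cycle-injective to C₁-injective; cycle-adjacent to C₁-adjacent
    ; edge-cover to edge-cover₁; edge-unique to edge-unique₁; end-cover to end-cover₁; end-unique to end-unique₁ )
  open SegmentedDecomposition D₂ renaming
    ( cycle to C₂; cycle-injective to C₂-injective; cycle-adjacent to C₂-adjacent
    ; edge-cover to edge-cover₂; edge-unique to edge-unique₂; end-cover to end-cover₂; end-unique to end-unique₂ )

  n′ : ℕ
  n′ = odd n

  Index : Set
  Index = I₁ × I₂ × Fin H

  Place : Set
  Place = Bool × Fin N × Bool × Fin N

  start : Fin H → Bool → Fin N
  start β e = unhalve (e , β)

  restRow : Fin H → Bool → Fin N → Fin N
  restRow β e α = row (start β e) α

  walk₂ : Bool → Fin N → Fin N → Pos n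
  walk₂ true  λ′ u = succ (λ′ , u)
  walk₂ false λ′ u = rot n λ′ , opposite u

  -- Segment (e , α) of the cycle (i₁ , i₂ , β) first (σ = false) runs through segment α of C₁
  -- while C₂ rests at the start of its segment `restRow β e α`, and then (σ = true) through one
  -- segment of C₂, forwards or backwards, while C₁ rests at the end of segment α.
  vertex′ : I₁ → I₂ → Fin H → Bool → Fin N → Bool → Fin N → Vertex (d₁ + d₂)
  vertex′ i₁ i₂ β e α false u = C₁ i₁ (α , u) ++ C₂ i₂ (restRow β e α , fz)
  vertex′ i₁ i₂ β e α true  u = C₁ i₁ (α , fromℕ n) ++ C₂ i₂ (walk₂ (forward α) (restRow β e α) u)

  vertexAt : Index → Place → Vertex (d₁ + d₂)
  vertexAt (i₁ , i₂ , β) (e , α , σ , u) = vertex′ i₁ i₂ β e α σ u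

  place : Pos n′ → Place
  place (s , t) = proj₁ (halve s) , proj₂ (halve s) , proj₁ (halve t) , proj₂ (halve t)

  unplace : Place → Pos n′
  unplace (e , α , σ , u) = unhalve (e , α) , unhalve (σ , u)

  place-unplace : ∀ x → place (unplace x) ≡ x
  place-unplace (e , α , σ , u) rewrite halve-unhalve {n} (e , α) | halve-unhalve {n} (σ , u) = refl

  unplace-place : ∀ p → unplace (place p) ≡ p
  unplace-place (s , t) = cong₂ _,_ (unhalve-halve s) (unhalve-halve t)

  vertex : Index → Pos n′ → Vertex (d₁ + d₂)
  vertex ι p = vertexAt ι (place p)

  succWalk₂ : Bool → Fin N → Fin N → Bool → Place
  succWalk₂ e α u true  = e xor isLast α , rot 1 α , false , rot 1 u
  succWalk₂ e α u false = e , α , true , rot 1 u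

  succPlace : Place → Place
  succPlace (e , α , false , u) = e , α , isLast u , rot 1 u
  succPlace (e , α , true  , u) = succWalk₂ e α u (isLast u)

  succ-unplace : ∀ x → succ (unplace x) ≡ unplace (succPlace x)
  succ-unplace (e , α , false , u) rewrite isLast-unhalve false u | rot1-unhalve false u = refl
  succ-unplace (e , α , true  , u) rewrite isLast-unhalve true u | rot1-unhalve true u with isLast u
  ... | true rewrite rot1-unhalve e α = refl
  ... | false = refl

  place-succ : ∀ p → place (succ p) ≡ succPlace (place p)
  place-succ p = begin
    place (succ p)                         ≡⟨ cong (λ z → place (succ z)) (unplace-place p) ⟨
    place (succ (unplace (place p)))       ≡⟨ cong place (succ-unplace (place p)) ⟩
    place (unplace (succPlace (place p)))  ≡⟨ place-unplace _ ⟩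
    succPlace (place p)                    ∎
    where open ≡-Reasoning

  restRow-next : ∀ β e α → restRow β (e xor isLast α) (rot 1 α) ≡ nextRow (start β e) α
  restRow-next β e α with isLast α in eq
  ... | false rewrite xor-identityʳ e = row-rot1 (start β e) α eq
  ... | true rewrite xor-comm e true | true-xor e | isLast⇒≡fromℕ α eq | rot1-fromℕ {n} = begin
    rot 0 (unhalve (not e , β))    ≡⟨ rot-zero _ ⟩
    unhalve (not e , β)            ≡⟨ rotH-unhalve e β ⟨
    rot H (start β e)              ≡⟨ nextRow-last (start β e) ⟨
    nextRow (start β e) (fromℕ n)  ∎
    where open ≡-Reasoning

  restRow-not : ∀ β e α → restRow β (not e) α ≡ rot H (restRow β e α)
  restRow-not β e α = trans (cong (λ z → row z α) (sym (rotH-unhalve e β))) (row-rotH (start β e) α)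

  restRow-injective : ∀ β e e′ α → restRow β e α ≡ restRow β e′ α → e ≡ e′
  restRow-injective β true  true  α _  = refl
  restRow-injective β false false α _  = refl
  restRow-injective β true  false α eq = ⊥-elim (rotH-fixpoint-free _ (trans (sym (restRow-not β true α)) (sym eq)))
  restRow-injective β false true  α eq = ⊥-elim (rotH-fixpoint-free _ (trans (sym (restRow-not β false α)) (sym eq)))

  restRow-step-≢ : ∀ β e e′ α b → restRow β e α ≢ rot (step b) (restRow β e′ α)
  restRow-step-≢ β true  true  α b eq = step-fixpoint-free b _ (sym eq)
  restRow-step-≢ β false false α b eq = step-fixpoint-free b _ (sym eq)
  restRow-step-≢ β true  false α b eq =
    step∘rotH-fixpoint-free b _ (trans (cong (rot (step b)) (sym (restRow-not β true α))) (sym eq))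
  restRow-step-≢ β false true  α b eq =
    step∘rotH-fixpoint-free b _ (trans (cong (rot (step b)) (sym (restRow-not β false α))) (sym eq))

  walk₂-last : ∀ b λ′ → walk₂ b λ′ (fromℕ n) ≡ (rot (step b) λ′ , fz)
  walk₂-last true  λ′ = succ-fromℕ λ′
  walk₂-last false λ′ = cong (rot n λ′ ,_) opposite-fromℕ

  succ-walk₂-backward : ∀ (λ′ u : Fin N) → isLast u ≡ false → succ (rot n λ′ , opposite (rot 1 u)) ≡ (rot n λ′ , opposite u)
  succ-walk₂-backward λ′ u eq =
    trans (succ-¬isLast (rot n λ′) (opposite (rot 1 u)) (trans (isLast-opposite (rot 1 u)) (trans (isZero-rot1 u) eq)))
          (cong (rot n λ′ ,_) (trans (cong (rot 1) (opposite-rot1 u)) (rot1-rotn (opposite u))))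

  C₂-adjacent-start : ∀ i₂ b λ′ → Adjacent (C₂ i₂ (λ′ , fz)) (C₂ i₂ (walk₂ b λ′ fz))
  C₂-adjacent-start i₂ true  λ′ = C₂-adjacent i₂ (λ′ , fz)
  C₂-adjacent-start i₂ false λ′ = Adjacent-sym {u = C₂ i₂ (rot n λ′ , fromℕ n)} {v = C₂ i₂ (λ′ , fz)}
    (subst (λ z → Adjacent (C₂ i₂ (rot n λ′ , fromℕ n)) (C₂ i₂ z))
           (trans (succ-fromℕ (rot n λ′)) (cong (_, fz) (rot1-rotn λ′))) (C₂-adjacent i₂ (rot n λ′ , fromℕ n)))

  C₂-adjacent-walk₂ : ∀ i₂ b λ′ u → isLast u ≡ false → Adjacent (C₂ i₂ (walk₂ b λ′ u)) (C₂ i₂ (walk₂ b λ′ (rot 1 u)))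
  C₂-adjacent-walk₂ i₂ true  λ′ u eq =
    subst (λ z → Adjacent (C₂ i₂ (succ (λ′ , u))) (C₂ i₂ (succ z))) (succ-¬isLast λ′ u eq) (C₂-adjacent i₂ (succ (λ′ , u)))
  C₂-adjacent-walk₂ i₂ false λ′ u eq = Adjacent-sym {u = C₂ i₂ q} {v = C₂ i₂ (rot n λ′ , opposite u)}
    (subst (λ z → Adjacent (C₂ i₂ q) (C₂ i₂ z)) (succ-walk₂-backward λ′ u eq) (C₂-adjacent i₂ q))
    where
    q = rot n λ′ , opposite (rot 1 u)

  vertexAt-adjacent : ∀ ι x → Adjacent (vertexAt ι x) (vertexAt ι (succPlace x))
  vertexAt-adjacent (i₁ , i₂ , β) (e , α , false , u) with isLast u in eq
  ... | false = Adjacent-++ˡ {x = C₁ i₁ (α , u)} {x′ = C₁ i₁ (α , rot 1 u)} (C₂ i₂ (restRow β e α , fz))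
                  (subst (λ z → Adjacent (C₁ i₁ (α , u)) (C₁ i₁ z)) (succ-¬isLast α u eq) (C₁-adjacent i₁ (α , u)))
  ... | true with isLast⇒≡fromℕ u eq
  ...   | refl rewrite rot1-fromℕ {n} =
    Adjacent-++ʳ (C₁ i₁ (α , fromℕ n)) {y = C₂ i₂ (restRow β e α , fz)} {y′ = C₂ i₂ (walk₂ (forward α) (restRow β e α) fz)}
      (C₂-adjacent-start i₂ (forward α) (restRow β e α))
  vertexAt-adjacent (i₁ , i₂ , β) (e , α , true , u) with isLast u in eq
  ... | false =
    Adjacent-++ʳ (C₁ i₁ (α , fromℕ n)) {y = C₂ i₂ (walk₂ (forward α) (restRow β e α) u)}
      {y′ = C₂ i₂ (walk₂ (forward α) (restRow β e α) (rot 1 u))} (C₂-adjacent-walk₂ i₂ (forward α) (restRow β e α) u eq)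
  ... | true with isLast⇒≡fromℕ u eq
  ...   | refl rewrite rot1-fromℕ {n} | walk₂-last (forward α) (restRow β e α) | restRow-next β e α =
    Adjacent-++ˡ {x = C₁ i₁ (α , fromℕ n)} {x′ = C₁ i₁ (rot 1 α , fz)} (C₂ i₂ (nextRow (start β e) α , fz))
      (subst (λ z → Adjacent (C₁ i₁ (α , fromℕ n)) (C₁ i₁ z)) (succ-fromℕ α) (C₁-adjacent i₁ (α , fromℕ n)))

  vertex-adjacent : ∀ ι p → Adjacent (vertex ι p) (vertex ι (succ p))
  vertex-adjacent ι p = subst (λ z → Adjacent (vertex ι p) (vertexAt ι z)) (sym (place-succ p)) (vertexAt-adjacent ι (place p))

  walk₂-start : ∀ b λ′ λ′′ u′ → (λ′ , fz) ≡ walk₂ b λ′′ u′ → λ′ ≡ rot (step b) λ′′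
  walk₂-start true  λ′ λ′′ u′ eq with isLast u′ in eq′
  ... | true  = cong proj₁ eq
  ... | false with () ← trans (cong (λ z → isZero (proj₂ z)) eq) (trans (isZero-rot1 u′) eq′)
  walk₂-start false λ′ λ′′ u′ eq = cong proj₁ eq

  walk₂-injective : ∀ b λ′ λ′′ u u′ → walk₂ b λ′ u ≡ walk₂ b λ′′ u′ → λ′ ≡ λ′′ × u ≡ u′
  walk₂-injective true  λ′ λ′′ u u′ eq = ,-injective (succ-injective eq)
  walk₂-injective false λ′ λ′′ u u′ eq = rot-injective n (cong proj₁ eq) , opposite-injective (cong proj₂ eq)

  vertex′-halves-disjoint : ∀ {i₁ i₂ β} e α u e′ α′ u′ → vertex′ i₁ i₂ β e α false u ≢ vertex′ i₁ i₂ β e′ α′ true u′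
  vertex′-halves-disjoint {i₁} {i₂} {β} e α u e′ α′ u′ eq
    with C₁-injective i₁ (++-injectiveˡ (C₁ i₁ (α , u)) (C₁ i₁ (α′ , fromℕ n)) eq)
  ... | refl = restRow-step-≢ β e e′ α (forward α)
                 (walk₂-start (forward α) (restRow β e α) (restRow β e′ α) u′
                   (C₂-injective i₂ (++-injectiveʳ (C₁ i₁ (α , u)) (C₁ i₁ (α′ , fromℕ n)) eq)))

  vertexAt-injective : ∀ ι x y → vertexAt ι x ≡ vertexAt ι y → x ≡ y
  vertexAt-injective (i₁ , i₂ , β) (e , α , false , u) (e′ , α′ , false , u′) eq
    with C₁-injective i₁ (++-injectiveˡ (C₁ i₁ (α , u)) (C₁ i₁ (α′ , u′)) eq)
  ... | refl = cong (_, α , false , u)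
                 (restRow-injective β e e′ α (cong proj₁ (C₂-injective i₂ (++-injectiveʳ (C₁ i₁ (α , u)) (C₁ i₁ (α , u)) eq))))
  vertexAt-injective _ (e , α , false , u) (e′ , α′ , true  , u′) eq = ⊥-elim (vertex′-halves-disjoint e α u e′ α′ u′ eq)
  vertexAt-injective _ (e , α , true  , u) (e′ , α′ , false , u′) eq = ⊥-elim (vertex′-halves-disjoint e′ α′ u′ e α u (sym eq))
  vertexAt-injective (i₁ , i₂ , β) (e , α , true , u) (e′ , α′ , true , u′) eq
    with C₁-injective i₁ (++-injectiveˡ (C₁ i₁ (α , fromℕ n)) (C₁ i₁ (α′ , fromℕ n)) eq)
  ... | refl with walk₂-injective (forward α) (restRow β e α) (restRow β e′ α) u u′
                    (C₂-injective i₂ (++-injectiveʳ (C₁ i₁ (α , fromℕ n)) (C₁ i₁ (α , fromℕ n)) eq))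
  ...   | eq′ , refl = cong (_, α , true , u) (restRow-injective β e e′ α eq′)

  vertex-injective : ∀ ι {p q} → vertex ι p ≡ vertex ι q → p ≡ q
  vertex-injective ι {p} {q} eq =
    trans (sym (unplace-place p)) (trans (cong unplace (vertexAt-injective ι (place p) (place q) eq)) (unplace-place q))

  -- The cycles of the product use exactly the edges `edge₁` (an edge of C₁ beside the start of a
  -- segment of C₂) and `edge₂` (the end of a segment of C₁ beside an edge of C₂), each once:
  -- `encode` and `decode` are mutually inverse.
  data EdgeCode : Set where
    edge₁ : I₁ → Pos n → I₂ → Fin N → EdgeCode
    edge₂ : I₂ → Pos n → I₁ → Fin N → EdgeCode

  tail : EdgeCode → Vertex (d₁ + d₂)
  tail (edge₁ i₁ q i₂ λ′) = C₁ i₁ q ++ C₂ i₂ (λ′ , fz)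
  tail (edge₂ i₂ q i₁ α)  = C₁ i₁ (α , fromℕ n) ++ C₂ i₂ q

  head : EdgeCode → Vertex (d₁ + d₂)
  head (edge₁ i₁ q i₂ λ′) = C₁ i₁ (succ q) ++ C₂ i₂ (λ′ , fz)
  head (edge₂ i₂ q i₁ α)  = C₁ i₁ (α , fromℕ n) ++ C₂ i₂ (succ q)

  startEdge : Bool → Fin N → Pos n
  startEdge true  λ′ = λ′ , fz
  startEdge false λ′ = rot n λ′ , fromℕ n

  walkEdge : Bool → Fin N → Fin N → Pos n
  walkEdge true  λ′ u = succ (λ′ , u)
  walkEdge false λ′ u = rot n λ′ , opposite (rot 1 u)

  encode₁ : I₁ → I₂ → Fin H → Bool → Fin N → Fin N → Bool → EdgeCode
  encode₁ i₁ i₂ β e α u false = edge₁ i₁ (α , u) i₂ (restRow β e α)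
  encode₁ i₁ i₂ β e α u true  = edge₂ i₂ (startEdge (forward α) (restRow β e α)) i₁ α

  encode₂ : I₁ → I₂ → Fin H → Bool → Fin N → Fin N → Bool → EdgeCode
  encode₂ i₁ i₂ β e α u false = edge₂ i₂ (walkEdge (forward α) (restRow β e α) u) i₁ α
  encode₂ i₁ i₂ β e α u true  = edge₁ i₁ (α , fromℕ n) i₂ (nextRow (start β e) α)

  encode : Index → Place → EdgeCode
  encode (i₁ , i₂ , β) (e , α , false , u) = encode₁ i₁ i₂ β e α u (isLast u)
  encode (i₁ , i₂ , β) (e , α , true  , u) = encode₂ i₁ i₂ β e α u (isLast u)

  located : I₁ → I₂ → Fin N → Bool → Fin N → Fin N → Index × Place
  located i₁ i₂ γ σ α u = (i₁ , i₂ , proj₂ (halve γ)) , proj₁ (halve γ) , α , σ , u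

  decode₁ : I₁ → Fin N → Fin N → I₂ → Fin N → Bool → Index × Place
  decode₁ i₁ α u i₂ λ′ false = located i₁ i₂ (unrow λ′ α) false α u
  decode₁ i₁ α u i₂ λ′ true  = located i₁ i₂ (unnextRow λ′ α) true α (fromℕ n)

  decodeForward : I₂ → Fin N → Fin N → I₁ → Fin N → Bool → Index × Place
  decodeForward i₂ μ w i₁ α true  = located i₁ i₂ (unrow μ α) false α (fromℕ n)
  decodeForward i₂ μ w i₁ α false = located i₁ i₂ (unrow μ α) true α (rot n w)

  decodeBackward : I₂ → Fin N → Fin N → I₁ → Fin N → Bool → Index × Place
  decodeBackward i₂ μ w i₁ α true  = located i₁ i₂ (unrow (rot 1 μ) α) false α (fromℕ n)
  decodeBackward i₂ μ w i₁ α false = located i₁ i₂ (unrow (rot 1 μ) α) true α (rot n (opposite w))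

  decode₂ : I₂ → Fin N → Fin N → I₁ → Fin N → Bool → Index × Place
  decode₂ i₂ μ w i₁ α true  = decodeForward i₂ μ w i₁ α (isZero w)
  decode₂ i₂ μ w i₁ α false = decodeBackward i₂ μ w i₁ α (isLast w)

  decode : EdgeCode → Index × Place
  decode (edge₁ i₁ (α , u) i₂ λ′) = decode₁ i₁ α u i₂ λ′ (isLast u)
  decode (edge₂ i₂ (μ , w) i₁ α)  = decode₂ i₂ μ w i₁ α (forward α)

  halve-unrow-restRow : ∀ β e α → halve (unrow (restRow β e α) α) ≡ (e , β)
  halve-unrow-restRow β e α = trans (cong halve (unrow-row (start β e) α)) (halve-unhalve (e , β))

  halve-unnextRow-nextRow : ∀ β e α → halve (unnextRow (nextRow (start β e) α) α) ≡ (e , β)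
  halve-unnextRow-nextRow β e α = trans (cong halve (unnextRow-nextRow (start β e) α)) (halve-unhalve (e , β))

  restRowAt : Fin N → Fin N → Fin N
  restRowAt λ′ α = restRow (proj₂ (halve (unrow λ′ α))) (proj₁ (halve (unrow λ′ α))) α

  restRowAt≡ : ∀ λ′ α → restRowAt λ′ α ≡ λ′
  restRowAt≡ λ′ α = trans (cong (λ z → row z α) (unhalve-halve (unrow λ′ α))) (row-unrow λ′ α)

  nextRow-halve-unnextRow : ∀ λ′ α → nextRow (start (proj₂ (halve (unnextRow λ′ α))) (proj₁ (halve (unnextRow λ′ α)))) α ≡ λ′
  nextRow-halve-unnextRow λ′ α = trans (cong (λ z → nextRow z α) (unhalve-halve (unnextRow λ′ α))) (nextRow-unnextRow λ′ α)

  located≡ : ∀ {i₁ i₂ γ β e α σ u u′} → halve γ ≡ (e , β) → u ≡ u′ → located i₁ i₂ γ σ α u ≡ ((i₁ , i₂ , β) , e , α , σ , u′)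
  located≡ {γ = γ} eq refl with halve γ
  located≡ refl refl | _ = refl

  decode-encode : ∀ ι x → decode (encode ι x) ≡ (ι , x)
  decode-encode (i₁ , i₂ , β) (e , α , false , u) with isLast u in eq
  ... | false rewrite eq = located≡ (halve-unrow-restRow β e α) refl
  ... | true with isLast⇒≡fromℕ u eq
  ...   | refl with forward α
  ...     | true = located≡ (halve-unrow-restRow β e α) refl
  ...     | false rewrite isLast-fromℕ n =
    located≡ (trans (cong (λ z → halve (unrow z α)) (rot1-rotn (restRow β e α))) (halve-unrow-restRow β e α)) refl
  decode-encode (i₁ , i₂ , β) (e , α , true , u) with isLast u in eq
  ... | true with isLast⇒≡fromℕ u eq
  ...   | refl rewrite isLast-fromℕ n = located≡ (halve-unnextRow-nextRow β e α) refl
  decode-encode (i₁ , i₂ , β) (e , α , true , u) | false with forward α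
  ...   | true rewrite isZero-rot1 u | eq = located≡ (halve-unrow-restRow β e α) (rotn-rot1 u)
  ...   | false rewrite isLast-opposite (rot 1 u) | isZero-rot1 u | eq =
    located≡ (trans (cong (λ z → halve (unrow z α)) (rot1-rotn (restRow β e α))) (halve-unrow-restRow β e α))
             (trans (cong (rot n) (opposite-involutive (rot 1 u))) (rotn-rot1 u))

  encode₁-¬isLast : ∀ i₁ i₂ β e α u → isLast u ≡ false → encode (i₁ , i₂ , β) (e , α , false , u) ≡ edge₁ i₁ (α , u) i₂ (restRow β e α)
  encode₁-¬isLast i₁ i₂ β e α u eq rewrite eq = refl

  encode₁-fromℕ : ∀ i₁ i₂ β e α →
                  encode (i₁ , i₂ , β) (e , α , false , fromℕ n) ≡ edge₂ i₂ (startEdge (forward α) (restRow β e α)) i₁ α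
  encode₁-fromℕ i₁ i₂ β e α rewrite isLast-fromℕ n = refl

  encode₂-¬isLast : ∀ i₁ i₂ β e α u → isLast u ≡ false →
                    encode (i₁ , i₂ , β) (e , α , true , u) ≡ edge₂ i₂ (walkEdge (forward α) (restRow β e α) u) i₁ α
  encode₂-¬isLast i₁ i₂ β e α u eq rewrite eq = refl

  encode₂-fromℕ : ∀ i₁ i₂ β e α →
                  encode (i₁ , i₂ , β) (e , α , true , fromℕ n) ≡ edge₁ i₁ (α , fromℕ n) i₂ (nextRow (start β e) α)
  encode₂-fromℕ i₁ i₂ β e α rewrite isLast-fromℕ n = refl

  encode-decode : ∀ κ → encode (proj₁ (decode κ)) (proj₂ (decode κ)) ≡ κ
  encode-decode (edge₁ i₁ (α , u) i₂ λ′) with isLast u in eq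
  ... | false = trans (encode₁-¬isLast i₁ i₂ _ _ α u eq) (cong (edge₁ i₁ (α , u) i₂) (restRowAt≡ λ′ α))
  ... | true with isLast⇒≡fromℕ u eq
  ...   | refl = trans (encode₂-fromℕ i₁ i₂ _ _ α) (cong (edge₁ i₁ (α , fromℕ n) i₂) (nextRow-halve-unnextRow λ′ α))
  encode-decode (edge₂ i₂ (μ , w) i₁ α) with forward α in eqα
  ... | true with isZero w in eqw
  ...   | true with isZero⇒≡zero w eqw
  ...     | refl = trans (encode₁-fromℕ i₁ i₂ _ _ α) (cong (λ z → edge₂ i₂ z i₁ α)
                     (trans (cong (λ b → startEdge b (restRowAt μ α)) eqα) (cong (_, fz) (restRowAt≡ μ α))))
  encode-decode (edge₂ i₂ (μ , w) i₁ α) | true | false =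
    trans (encode₂-¬isLast i₁ i₂ _ _ α (rot n w) (trans (isLast-rotn w) eqw)) (cong (λ z → edge₂ i₂ z i₁ α)
      (trans (cong (λ b → walkEdge b (restRowAt μ α) (rot n w)) eqα)
        (trans (succ-¬isLast (restRowAt μ α) (rot n w) (trans (isLast-rotn w) eqw)) (cong₂ _,_ (restRowAt≡ μ α) (rot1-rotn w)))))
  encode-decode (edge₂ i₂ (μ , w) i₁ α) | false with isLast w in eqw
  ...   | true with isLast⇒≡fromℕ w eqw
  ...     | refl = trans (encode₁-fromℕ i₁ i₂ _ _ α) (cong (λ z → edge₂ i₂ z i₁ α)
                     (trans (cong (λ b → startEdge b (restRowAt (rot 1 μ) α)) eqα)
                       (cong (_, fromℕ n) (trans (cong (rot n) (restRowAt≡ (rot 1 μ) α)) (rotn-rot1 μ)))))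
  encode-decode (edge₂ i₂ (μ , w) i₁ α) | false | false =
    trans (encode₂-¬isLast i₁ i₂ _ _ α (rot n (opposite w)) (trans (isLast-rotn (opposite w)) (trans (isZero-opposite w) eqw)))
      (cong (λ z → edge₂ i₂ z i₁ α) (trans (cong (λ b → walkEdge b (restRowAt (rot 1 μ) α) (rot n (opposite w))) eqα)
        (cong₂ _,_ (trans (cong (rot n) (restRowAt≡ (rot 1 μ) α)) (rotn-rot1 μ))
                   (trans (cong opposite (rot1-rotn (opposite w))) (opposite-involutive w)))))

  encode-sound : ∀ ι x → SameEdge (vertexAt ι x) (vertexAt ι (succPlace x)) (tail (encode ι x)) (head (encode ι x))
  encode-sound (i₁ , i₂ , β) (e , α , false , u) with isLast u in eq
  ... | false = inj₁ (refl , cong (λ z → C₁ i₁ z ++ C₂ i₂ (restRow β e α , fz)) (sym (succ-¬isLast α u eq)))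
  ... | true with isLast⇒≡fromℕ u eq
  ...   | refl rewrite rot1-fromℕ {n} with forward α
  ...     | true  = inj₁ (refl , refl)
  ...     | false = inj₂ (cong (λ z → C₁ i₁ (α , fromℕ n) ++ C₂ i₂ z)
                       (sym (trans (succ-fromℕ (rot n (restRow β e α))) (cong (_, fz) (rot1-rotn (restRow β e α))))) , refl)
  encode-sound (i₁ , i₂ , β) (e , α , true , u) with isLast u in eq
  ... | false with forward α
  ...   | true  = inj₁ (refl , cong (λ z → C₁ i₁ (α , fromℕ n) ++ C₂ i₂ (succ z)) (sym (succ-¬isLast (restRow β e α) u eq)))
  ...   | false = inj₂ (cong (λ z → C₁ i₁ (α , fromℕ n) ++ C₂ i₂ z) (sym (succ-walk₂-backward (restRow β e α) u eq)) , refl)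
  encode-sound (i₁ , i₂ , β) (e , α , true , u) | true with isLast⇒≡fromℕ u eq
  ...   | refl = inj₁ (cong (λ z → C₁ i₁ (α , fromℕ n) ++ C₂ i₂ z) (walk₂-last (forward α) (restRow β e α)) ,
                       cong₂ (λ z w → C₁ i₁ z ++ C₂ i₂ (w , fz)) (trans (cong (rot 1 α ,_) (rot1-fromℕ {n})) (sym (succ-fromℕ α)))
                             (restRow-next β e α))

  edgeCode-injective : ∀ κ κ′ → SameEdge (tail κ) (head κ) (tail κ′) (head κ′) → κ ≡ κ′
  edgeCode-injective (edge₁ i₁ q i₂ λ′) (edge₁ i₁′ q′ i₂′ λ′′) s
    with SameEdge-++ˡ⁻ {x = C₁ i₁ q} {x′ = C₁ i₁ (succ q)} {z = C₁ i₁′ q′} {z′ = C₁ i₁′ (succ q′)} s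
  ... | s₁ , eq with edge-unique₁ s₁ | end-unique₂ {i₂} {λ′} {false} {i₂′} {λ′′} {false} eq
  ...   | refl , refl | refl , refl , _ = refl
  edgeCode-injective (edge₂ i₂ q i₁ α) (edge₂ i₂′ q′ i₁′ α′) s
    with SameEdge-++ʳ⁻ {x = C₁ i₁ (α , fromℕ n)} {x′ = C₁ i₁′ (α′ , fromℕ n)} {y = C₂ i₂ q} {y′ = C₂ i₂ (succ q)} s
  ... | eq , s₂ with edge-unique₂ s₂ | end-unique₁ {i₁} {α} {true} {i₁′} {α′} {true} eq
  ...   | refl , refl | refl , refl , _ = refl
  edgeCode-injective (edge₁ i₁ q i₂ λ′) (edge₂ i₂′ q′ i₁′ α′) s =
    ⊥-elim (SameEdge-++ˡʳ {x = C₁ i₁ q} {x′ = C₁ i₁ (succ q)} {z = C₁ i₁′ (α′ , fromℕ n)} (C₁-adjacent i₁ q) s)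
  edgeCode-injective (edge₂ i₂ q i₁ α) (edge₁ i₁′ q′ i₂′ λ′′) s =
    ⊥-elim (SameEdge-++ˡʳ {x = C₁ i₁′ q′} {x′ = C₁ i₁′ (succ q′)} {z = C₁ i₁ (α , fromℕ n)} (C₁-adjacent i₁′ q′) (SameEdge-sym s))

  vertex-edgeCode : ∀ ι p → SameEdge (vertex ι p) (vertex ι (succ p)) (tail (encode ι (place p))) (head (encode ι (place p)))
  vertex-edgeCode ι p = subst (λ z → SameEdge (vertex ι p) (vertexAt ι z) (tail (encode ι (place p))) (head (encode ι (place p))))
                              (sym (place-succ p)) (encode-sound ι (place p))

  edge-unique : ∀ {ι p ι′ p′} → SameEdge (vertex ι p) (vertex ι (succ p)) (vertex ι′ p′) (vertex ι′ (succ p′)) → ι ≡ ι′ × p ≡ p′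
  edge-unique {ι} {p} {ι′} {p′} s =
    cong proj₁ same , trans (sym (unplace-place p)) (trans (cong (λ z → unplace (proj₂ z)) same) (unplace-place p′))
    where
    same-code : encode ι (place p) ≡ encode ι′ (place p′)
    same-code = edgeCode-injective _ _ (SameEdge-trans (SameEdge-sym (vertex-edgeCode ι p)) (SameEdge-trans s (vertex-edgeCode ι′ p′)))
    same : (ι , place p) ≡ (ι′ , place p′)
    same = trans (sym (decode-encode ι (place p))) (trans (cong decode same-code) (decode-encode ι′ (place p′)))

  edgeCode-edge : ∀ κ → Σ (Index × Pos n′) λ (ι , p) → SameEdge (tail κ) (head κ) (vertex ι p) (vertex ι (succ p))
  edgeCode-edge κ =
    (ι , p) , SameEdge-sym (subst (λ z → SameEdge (vertex ι p) (vertex ι (succ p)) (tail z) (head z)) encode≡κ (vertex-edgeCode ι p))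
    where
    ι = proj₁ (decode κ)
    p = unplace (proj₂ (decode κ))
    encode≡κ : encode ι (place p) ≡ κ
    encode≡κ = trans (cong (encode ι) (place-unplace (proj₂ (decode κ)))) (encode-decode κ)

  EndCode : Set
  EndCode = I₁ × Fin N × Bool × I₂ × Fin N

  endVertex : EndCode → Vertex (d₁ + d₂)
  endVertex (i₁ , α , e₁ , i₂ , λ′) = C₁ i₁ (α , segmentEnd e₁) ++ C₂ i₂ (λ′ , fz)

  encodeEnd : Index → Bool × Fin N → Bool → EndCode
  encodeEnd (i₁ , i₂ , β) (e , α) false = i₁ , α , false , i₂ , restRow β e α
  encodeEnd (i₁ , i₂ , β) (e , α) true  = i₁ , α , true , i₂ , nextRow (start β e) α

  decodeEnd : EndCode → Index × (Bool × Fin N) × Bool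
  decodeEnd (i₁ , α , false , i₂ , λ′) = (i₁ , i₂ , proj₂ (halve (unrow λ′ α))) , (proj₁ (halve (unrow λ′ α)) , α) , false
  decodeEnd (i₁ , α , true  , i₂ , λ′) = (i₁ , i₂ , proj₂ (halve (unnextRow λ′ α))) , (proj₁ (halve (unnextRow λ′ α)) , α) , true

  vertex-segmentEnd : ∀ ι j e → vertex ι (j , segmentEnd e) ≡ endVertex (encodeEnd ι (halve j) e)
  vertex-segmentEnd (i₁ , i₂ , β) j false rewrite halve-unhalve {n} (false , fz) = refl
  vertex-segmentEnd (i₁ , i₂ , β) j true rewrite sym (unhalve-fromℕ {n}) | halve-unhalve (true , fromℕ n) =
    cong (λ z → C₁ i₁ (proj₂ (halve j) , fromℕ n) ++ C₂ i₂ z)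
         (walk₂-last (forward (proj₂ (halve j))) (restRow β (proj₁ (halve j)) (proj₂ (halve j))))

  decodeEnd-encodeEnd : ∀ ι x e → decodeEnd (encodeEnd ι x e) ≡ (ι , x , e)
  decodeEnd-encodeEnd (i₁ , i₂ , β) (e , α) false rewrite halve-unrow-restRow β e α = refl
  decodeEnd-encodeEnd (i₁ , i₂ , β) (e , α) true  rewrite halve-unnextRow-nextRow β e α = refl

  encodeEnd-decodeEnd : ∀ κ → let (ι , x , e) = decodeEnd κ in encodeEnd ι x e ≡ κ
  encodeEnd-decodeEnd (i₁ , α , false , i₂ , λ′) = cong (λ z → i₁ , α , false , i₂ , z) (restRowAt≡ λ′ α)
  encodeEnd-decodeEnd (i₁ , α , true  , i₂ , λ′) = cong (λ z → i₁ , α , true , i₂ , z) (nextRow-halve-unnextRow λ′ α)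

  endVertex-injective : ∀ κ κ′ → endVertex κ ≡ endVertex κ′ → κ ≡ κ′
  endVertex-injective (i₁ , α , e₁ , i₂ , λ′) (i₁′ , α′ , e₁′ , i₂′ , λ′′) eq
    with end-unique₁ {i₁} {α} {e₁} {i₁′} {α′} {e₁′} (++-injectiveˡ (C₁ i₁ (α , segmentEnd e₁)) (C₁ i₁′ (α′ , segmentEnd e₁′)) eq)
  ... | refl , refl , refl
    with end-unique₂ {i₂} {λ′} {false} {i₂′} {λ′′} {false} (++-injectiveʳ (C₁ i₁ (α , segmentEnd e₁)) (C₁ i₁ (α , segmentEnd e₁)) eq)
  ...   | refl , refl , _ = refl

  endCode-end : ∀ κ → Σ (Index × Fin (suc n′) × Bool) λ (ι , j , e) → endVertex κ ≡ vertex ι (j , segmentEnd e)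
  endCode-end κ = (ι , unhalve x , e) , sym (begin
    vertex ι (unhalve x , segmentEnd e)          ≡⟨ vertex-segmentEnd ι (unhalve x) e ⟩
    endVertex (encodeEnd ι (halve (unhalve x)) e) ≡⟨ cong (λ z → endVertex (encodeEnd ι z e)) (halve-unhalve x) ⟩
    endVertex (encodeEnd ι x e)                  ≡⟨ cong endVertex (encodeEnd-decodeEnd κ) ⟩
    endVertex κ                                  ∎)
    where
    open ≡-Reasoning
    ι = proj₁ (decodeEnd κ)
    x = proj₁ (proj₂ (decodeEnd κ))
    e = proj₂ (proj₂ (decodeEnd κ))

  end-unique : ∀ {ι j e ι′ j′ e′} → vertex ι (j , segmentEnd e) ≡ vertex ι′ (j′ , segmentEnd e′) → ι ≡ ι′ × j ≡ j′ × e ≡ e′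
  end-unique {ι} {j} {e} {ι′} {j′} {e′} eq =
    cong proj₁ same , halve-injective (cong (λ z → proj₁ (proj₂ z)) same) , cong (λ z → proj₂ (proj₂ z)) same
    where
    same-code : encodeEnd ι (halve j) e ≡ encodeEnd ι′ (halve j′) e′
    same-code = endVertex-injective _ _ (trans (sym (vertex-segmentEnd ι j e)) (trans eq (vertex-segmentEnd ι′ j′ e′)))
    same : (ι , halve j , e) ≡ (ι′ , halve j′ , e′)
    same = trans (sym (decodeEnd-encodeEnd ι (halve j) e)) (trans (cong decodeEnd same-code) (decodeEnd-encodeEnd ι′ (halve j′) e′))

module Doubling {d : ℕ} {I : Set} (k′ : ℕ) (D : SegmentedDecomposition d (odd (odd k′)) I) where
  open Schedule k′
  open SegmentedDecomposition D
  module R = SegmentedDecomposition (reverse D)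
  module Fwd = Product k′ D D
  module Rev = Product k′ (reverse D) (reverse D)

  n′ : ℕ
  n′ = odd n

  Indexᴰ : Set
  Indexᴰ = I × I × Bool × Fin H

  cycleᴰ : Indexᴰ → Pos n′ → Vertex (d + d)
  cycleᴰ (i₁ , i₂ , false , β) = Fwd.vertex (i₁ , i₂ , β)
  cycleᴰ (i₁ , i₂ , true  , β) = Rev.vertex (i₁ , i₂ , β)

  reverse-segmentEnd : ∀ i j e → R.cycle i (j , segmentEnd e) ≡ cycle i (opposite j , segmentEnd (not e))
  reverse-segmentEnd = cycleʳ-segmentEnd D

  segmentEnd-reverse : ∀ i j e → cycle i (j , segmentEnd e) ≡ R.cycle i (opposite j , segmentEnd (not e))
  segmentEnd-reverse i j e = sym (trans (reverse-segmentEnd i (opposite j) (not e))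
                                        (cong₂ (λ a b → cycle i (a , segmentEnd b)) (opposite-involutive j) (not-involutive e)))

  edgeCodes-disjoint : ∀ κ κ′ → ¬ SameEdge (Fwd.tail κ) (Fwd.head κ) (Rev.tail κ′) (Rev.head κ′)
  edgeCodes-disjoint (Fwd.edge₁ i₁ q i₂ λ′) (Rev.edge₁ i₁′ q′ i₂′ λ′′) s
    with SameEdge-++ˡ⁻ {x = cycle i₁ q} {x′ = cycle i₁ (succ q)} {z = R.cycle i₁′ q′} {z′ = R.cycle i₁′ (succ q′)} s
  ... | _ , eq =
    false≢true (proj₂ (proj₂ (end-unique {i₂} {λ′} {false} {i₂′} {opposite λ′′} {true} (trans eq (reverse-segmentEnd i₂′ λ′′ false)))))
  edgeCodes-disjoint (Fwd.edge₂ i₂ q i₁ α) (Rev.edge₂ i₂′ q′ i₁′ α′) s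
    with SameEdge-++ʳ⁻ {x = cycle i₁ (α , fromℕ n)} {x′ = R.cycle i₁′ (α′ , fromℕ n)} {y = cycle i₂ q} {y′ = cycle i₂ (succ q)} s
  ... | eq , _ =
    false≢true (sym (proj₂ (proj₂ (end-unique {i₁} {α} {true} {i₁′} {opposite α′} {false} (trans eq (reverse-segmentEnd i₁′ α′ true))))))
  edgeCodes-disjoint (Fwd.edge₁ i₁ q i₂ λ′) (Rev.edge₂ i₂′ q′ i₁′ α′) s =
    SameEdge-++ˡʳ {x = cycle i₁ q} {x′ = cycle i₁ (succ q)} {z = R.cycle i₁′ (α′ , fromℕ n)} (cycle-adjacent i₁ q) s
  edgeCodes-disjoint (Fwd.edge₂ i₂ q i₁ α) (Rev.edge₁ i₁′ q′ i₂′ λ′′) s =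
    SameEdge-++ˡʳ {x = R.cycle i₁′ q′} {x′ = R.cycle i₁′ (succ q′)} {z = cycle i₁ (α , fromℕ n)}
                  (R.cycle-adjacent i₁′ q′) (SameEdge-sym s)

  EdgeOfᴰ : Vertex (d + d) → Vertex (d + d) → Set
  EdgeOfᴰ u v = Σ (Indexᴰ × Pos n′) λ (j , p) → SameEdge u v (cycleᴰ j p) (cycleᴰ j (succ p))

  edgeOfᴰ-Fwd : ∀ {u v} κ → SameEdge u v (Fwd.tail κ) (Fwd.head κ) → EdgeOfᴰ u v
  edgeOfᴰ-Fwd κ s with Fwd.edgeCode-edge κ
  ... | ((i₁ , i₂ , β) , p) , s′ = ((i₁ , i₂ , false , β) , p) , SameEdge-trans s s′

  edgeOfᴰ-Rev : ∀ {u v} κ → SameEdge u v (Rev.tail κ) (Rev.head κ) → EdgeOfᴰ u v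
  edgeOfᴰ-Rev κ s with Rev.edgeCode-edge κ
  ... | ((i₁ , i₂ , β) , p) , s′ = ((i₁ , i₂ , true , β) , p) , SameEdge-trans s s′

  edge-cover-++ : ∀ x y x′ y′ → Adjacent (x ++ y) (x′ ++ y′) → EdgeOfᴰ (x ++ y) (x′ ++ y′)
  edge-cover-++ x y x′ y′ a with Adjacent-++⁻ x x′ y y′ a
  ... | inj₁ (x~x′ , refl) with end-cover y | edge-cover x x′ x~x′ | R.edge-cover x x′ x~x′
  ...   | (i₂ , λ′ , false) , refl | (i₁ , q) , s | _ = edgeOfᴰ-Fwd (Fwd.edge₁ i₁ q i₂ λ′) (SameEdge-++ˡ y s)
  ...   | (i₂ , λ′ , true)  , refl | _ | (i₁ , q) , s =
    edgeOfᴰ-Rev (Rev.edge₁ i₁ q i₂ (opposite λ′))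
      (subst (λ z → SameEdge (x ++ y) (x′ ++ y) (R.cycle i₁ q ++ z) (R.cycle i₁ (succ q) ++ z))
             (segmentEnd-reverse i₂ λ′ true) (SameEdge-++ˡ y s))
  edge-cover-++ x y x′ y′ a | inj₂ (refl , y~y′) with end-cover x | edge-cover y y′ y~y′ | R.edge-cover y y′ y~y′
  ...   | (i₁ , α , true)  , refl | (i₂ , q) , s | _ = edgeOfᴰ-Fwd (Fwd.edge₂ i₂ q i₁ α) (SameEdge-++ʳ x s)
  ...   | (i₁ , α , false) , refl | _ | (i₂ , q) , s =
    edgeOfᴰ-Rev (Rev.edge₂ i₂ q i₁ (opposite α))
      (subst (λ z → SameEdge (x ++ y) (x ++ y′) (z ++ R.cycle i₂ q) (z ++ R.cycle i₂ (succ q)))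
             (segmentEnd-reverse i₁ α false) (SameEdge-++ʳ x s))

  edge-coverᴰ : ∀ u v → Adjacent u v → EdgeOfᴰ u v
  edge-coverᴰ u v a with Vec.splitAt d u | Vec.splitAt d v
  ... | x , y , refl | x′ , y′ , refl = edge-cover-++ x y x′ y′ a

  edge-uniqueᴰ : ∀ {j p j′ p′} → SameEdge (cycleᴰ j p) (cycleᴰ j (succ p)) (cycleᴰ j′ p′) (cycleᴰ j′ (succ p′)) → j ≡ j′ × p ≡ p′
  edge-uniqueᴰ {_ , _ , false , _} {_} {_ , _ , false , _} s with Fwd.edge-unique s
  ... | refl , refl = refl , refl
  edge-uniqueᴰ {_ , _ , true , _} {_} {_ , _ , true , _} s with Rev.edge-unique s
  ... | refl , refl = refl , refl
  edge-uniqueᴰ {i₁ , i₂ , false , β} {p} {i₁′ , i₂′ , true , β′} {p′} s =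
    ⊥-elim (edgeCodes-disjoint (Fwd.encode (i₁ , i₂ , β) (Fwd.place p)) (Rev.encode (i₁′ , i₂′ , β′) (Rev.place p′))
                               (SameEdge-trans (SameEdge-sym (Fwd.vertex-edgeCode (i₁ , i₂ , β) p))
                                     (SameEdge-trans s (Rev.vertex-edgeCode (i₁′ , i₂′ , β′) p′))))
  edge-uniqueᴰ {i₁ , i₂ , true , β} {p} {i₁′ , i₂′ , false , β′} {p′} s =
    ⊥-elim (edgeCodes-disjoint (Fwd.encode (i₁′ , i₂′ , β′) (Fwd.place p′)) (Rev.encode (i₁ , i₂ , β) (Rev.place p))
                               (SameEdge-trans (SameEdge-sym (Fwd.vertex-edgeCode (i₁′ , i₂′ , β′) p′))
                                     (SameEdge-trans (SameEdge-sym s) (Rev.vertex-edgeCode (i₁ , i₂ , β) p))))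

  EndOfᴰ : Vertex (d + d) → Set
  EndOfᴰ v = Σ (Indexᴰ × Fin (suc n′) × Bool) λ (j , t , e) → v ≡ cycleᴰ j (t , segmentEnd e)

  end-cover-++ : ∀ x y → EndOfᴰ (x ++ y)
  end-cover-++ x y with end-cover x | end-cover y
  ... | (i₁ , α , e₁) , refl | (i₂ , λ′ , false) , refl with Fwd.endCode-end (i₁ , α , e₁ , i₂ , λ′)
  ...   | ((a , b , β) , t , e) , eq = ((a , b , false , β) , t , e) , eq
  end-cover-++ x y | (i₁ , α , e₁) , refl | (i₂ , λ′ , true) , refl with Rev.endCode-end (i₁ , opposite α , not e₁ , i₂ , opposite λ′)
  ...   | ((a , b , β) , t , e) , eq =
    ((a , b , true , β) , t , e) , trans (cong₂ _++_ (segmentEnd-reverse i₁ α e₁) (segmentEnd-reverse i₂ λ′ true)) eq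

  end-coverᴰ : ∀ v → EndOfᴰ v
  end-coverᴰ v with Vec.splitAt d v
  ... | x , y , refl = end-cover-++ x y

  ends-disjoint : ∀ ι t e ι′ t′ e′ → Fwd.vertex ι (t , segmentEnd e) ≢ Rev.vertex ι′ (t′ , segmentEnd e′)
  ends-disjoint ι t e ι′ t′ e′ eq =
    endVertices-disjoint (Fwd.encodeEnd ι (halve t) e) (Rev.encodeEnd ι′ (halve t′) e′)
      (trans (sym (Fwd.vertex-segmentEnd ι t e)) (trans eq (Rev.vertex-segmentEnd ι′ t′ e′)))
    where
    endVertices-disjoint : ∀ κ κ′ → Fwd.endVertex κ ≢ Rev.endVertex κ′
    endVertices-disjoint (i₁ , α , e₁ , i₂ , λ′) (i₁′ , α′ , e₁′ , i₂′ , λ′′) eq =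
      false≢true (proj₂ (proj₂ (end-unique (trans (++-injectiveʳ (cycle i₁ (α , segmentEnd e₁)) (R.cycle i₁′ (α′ , segmentEnd e₁′)) eq)
                                                 (reverse-segmentEnd i₂′ λ′′ false)))))

  end-uniqueᴰ : ∀ {j t e j′ t′ e′} → cycleᴰ j (t , segmentEnd e) ≡ cycleᴰ j′ (t′ , segmentEnd e′) → j ≡ j′ × t ≡ t′ × e ≡ e′
  end-uniqueᴰ {_ , _ , false , _} {t} {e} {_ , _ , false , _} {t′} {e′} eq with Fwd.end-unique {_} {t} {e} {_} {t′} {e′} eq
  ... | refl , refl , refl = refl , refl , refl
  end-uniqueᴰ {_ , _ , true , _} {t} {e} {_ , _ , true , _} {t′} {e′} eq with Rev.end-unique {_} {t} {e} {_} {t′} {e′} eq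
  ... | refl , refl , refl = refl , refl , refl
  end-uniqueᴰ {_ , _ , false , _} {t} {e} {_ , _ , true , _} {t′} {e′} eq = ⊥-elim (ends-disjoint _ t e _ t′ e′ eq)
  end-uniqueᴰ {_ , _ , true , _} {t} {e} {_ , _ , false , _} {t′} {e′} eq = ⊥-elim (ends-disjoint _ t′ e′ _ t e (sym eq))

  cycleᴰ-injective : ∀ j {p q} → cycleᴰ j p ≡ cycleᴰ j q → p ≡ q
  cycleᴰ-injective (i₁ , i₂ , false , β) = Fwd.vertex-injective (i₁ , i₂ , β)
  cycleᴰ-injective (i₁ , i₂ , true  , β) = Rev.vertex-injective (i₁ , i₂ , β)

  cycleᴰ-adjacent : ∀ j p → Adjacent (cycleᴰ j p) (cycleᴰ j (succ p))
  cycleᴰ-adjacent (i₁ , i₂ , false , β) = Fwd.vertex-adjacent (i₁ , i₂ , β)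
  cycleᴰ-adjacent (i₁ , i₂ , true  , β) = Rev.vertex-adjacent (i₁ , i₂ , β)

  double : SegmentedDecomposition (d + d) (odd n) Indexᴰ
  double = record
    { cycle           = cycleᴰ
    ; cycle-injective = cycleᴰ-injective
    ; cycle-adjacent  = cycleᴰ-adjacent
    ; edge-cover      = edge-coverᴰ
    ; edge-unique     = edge-uniqueᴰ
    ; end-cover       = end-coverᴰ
    ; end-unique      = end-uniqueᴰ
    }

flatten : ∀ {n} → Pos n → Fin (suc n * suc n)
flatten (j , t) = combine j t

unflatten : ∀ {n} → Fin (suc n * suc n) → Pos n
unflatten {n} k = remQuot (suc n) k

unflatten-flatten : ∀ {n} (p : Pos n) → unflatten (flatten p) ≡ p
unflatten-flatten (j , t) = remQuot-combine j t

flatten-unflatten : ∀ {n} (k : Fin (suc n * suc n)) → flatten {n} (unflatten k) ≡ k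
flatten-unflatten {n} k = combine-remQuot {suc n} (suc n) k

toℕ-next-< : ∀ {L} (k : Fin (suc L)) → suc (toℕ k) < suc L → toℕ (next k) ≡ suc (toℕ k)
toℕ-next-< {L} k lt = trans (toℕ-fromℕ< (m%n<n (suc (toℕ k)) (suc L))) (m<n⇒m%n≡m lt)

next-fromℕ : ∀ {L} → next (fromℕ L) ≡ fz
next-fromℕ {L} = toℕ-injective (begin
  toℕ (next (fromℕ L))       ≡⟨ toℕ-fromℕ< (m%n<n (suc (toℕ (fromℕ L))) (suc L)) ⟩
  suc (toℕ (fromℕ L)) % suc L ≡⟨ cong (λ z → suc z % suc L) (toℕ-fromℕ L) ⟩
  suc L % suc L              ≡⟨ n%n≡0 (suc L) ⟩
  0                          ∎)
  where open ≡-Reasoning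

*-+-< : ∀ N {a b} → a < N → b < N → N * a + b < N * N
*-+-< N {a} {b} a<N b<N = begin-strict
  N * a + b      <⟨ +-monoʳ-< (N * a) b<N ⟩
  N * a + N      ≡⟨ trans (+-comm (N * a) N) (sym (*-suc N a)) ⟩
  N * suc a      ≤⟨ *-monoʳ-≤ N a<N ⟩
  N * N          ∎
  where open ≤-Reasoning

next-flatten-¬isLast : ∀ {n} j (t : Fin (suc n)) → isLast t ≡ false → next (flatten (j , t)) ≡ flatten (j , rot 1 t)
next-flatten-¬isLast {n} j t eq = toℕ-injective (begin
  toℕ (next (flatten (j , t)))  ≡⟨ toℕ-next-< (flatten (j , t)) (subst (_< N * N) (sym (cong suc (toℕ-combine j t))) bound) ⟩
  suc (toℕ (combine j t))       ≡⟨ cong suc (toℕ-combine j t) ⟩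
  suc (N * toℕ j + toℕ t)       ≡⟨ +-suc (N * toℕ j) (toℕ t) ⟨
  N * toℕ j + suc (toℕ t)       ≡⟨ cong (N * toℕ j +_) (toℕ-rot1 t t<n) ⟨
  N * toℕ j + toℕ (rot 1 t)     ≡⟨ toℕ-combine j (rot 1 t) ⟨
  toℕ (flatten (j , rot 1 t))   ∎)
  where
  open ≡-Reasoning
  N = suc n
  t<n : toℕ t < n
  t<n = ¬isLast⇒< t eq
  bound : suc (N * toℕ j + toℕ t) < N * N
  bound = subst (_< N * N) (+-suc (N * toℕ j) (toℕ t)) (*-+-< N (toℕ<n j) (s≤s t<n))

next-flatten-fromℕ : ∀ {n} (j : Fin (suc n)) → isLast j ≡ false → next (flatten (j , fromℕ n)) ≡ flatten (rot 1 j , fz)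
next-flatten-fromℕ {n} j eq = toℕ-injective (begin
  toℕ (next (flatten (j , fromℕ n)))  ≡⟨ toℕ-next-< (flatten (j , fromℕ n)) (subst (_< N * N) (sym (cong suc toℕ-flatten)) bound) ⟩
  suc (toℕ (combine j (fromℕ n)))     ≡⟨ cong suc toℕ-flatten ⟩
  suc (n + N * toℕ j)                 ≡⟨ *-suc N (toℕ j) ⟨
  N * suc (toℕ j)                     ≡⟨ +-identityʳ (N * suc (toℕ j)) ⟨
  N * suc (toℕ j) + 0                 ≡⟨ cong (λ z → N * z + 0) (toℕ-rot1 j (¬isLast⇒< j eq)) ⟨
  N * toℕ (rot 1 j) + 0               ≡⟨ toℕ-combine (rot 1 j) (fz {n}) ⟨
  toℕ (flatten (rot 1 j , fz))        ∎)
  where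
  open ≡-Reasoning
  N = suc n
  toℕ-flatten : toℕ (combine j (fromℕ n)) ≡ n + N * toℕ j
  toℕ-flatten = trans (toℕ-combine j (fromℕ n)) (trans (cong (N * toℕ j +_) (toℕ-fromℕ n)) (+-comm (N * toℕ j) n))
  bound : suc (n + N * toℕ j) < N * N
  bound = subst (_< N * N) (trans (+-identityʳ _) (*-suc N (toℕ j))) (*-+-< N (s≤s (¬isLast⇒< j eq)) (s≤s z≤n))

flatten-fromℕ : ∀ {n} → flatten (fromℕ n , fromℕ n) ≡ fromℕ (n + n * suc n)
flatten-fromℕ {n} = toℕ-injective (begin
  toℕ (combine (fromℕ n) (fromℕ n))           ≡⟨ toℕ-combine (fromℕ n) (fromℕ n) ⟩
  suc n * toℕ (fromℕ n) + toℕ (fromℕ n)       ≡⟨ cong₂ (λ a b → suc n * a + b) (toℕ-fromℕ n) (toℕ-fromℕ n) ⟩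
  suc n * n + n                               ≡⟨ trans (+-comm (suc n * n) n) (cong (n +_) (*-comm (suc n) n)) ⟩
  n + n * suc n                               ≡⟨ toℕ-fromℕ (n + n * suc n) ⟨
  toℕ (fromℕ (n + n * suc n))                 ∎)
  where open ≡-Reasoning

next-flatten : ∀ {n} (p : Pos n) → next (flatten p) ≡ flatten (succ p)
next-flatten {n} (j , t) with isLast t in et
... | false = next-flatten-¬isLast j t et
... | true rewrite isLast⇒≡fromℕ t et | rot1-fromℕ {n} with isLast j in ej
...   | false = next-flatten-fromℕ j ej
...   | true rewrite isLast⇒≡fromℕ j ej | rot1-fromℕ {n} = trans (cong next (flatten-fromℕ {n})) next-fromℕ

unflatten-next : ∀ {n} (k : Fin (suc n * suc n)) → unflatten {n} (next k) ≡ succ (unflatten k)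
unflatten-next {n} k = begin
  unf (next k)                        ≡⟨ cong (λ z → unf (next z)) (flatten-unflatten {n} k) ⟨
  unf (next (flatten (unf k)))        ≡⟨ cong unf (next-flatten (unf k)) ⟩
  unf (flatten (succ (unf k)))        ≡⟨ unflatten-flatten (succ (unf k)) ⟩
  succ (unf k)                        ∎
  where
  open ≡-Reasoning
  unf : Fin (suc n * suc n) → Pos n
  unf = unflatten

CycleDecompositionWithMatching : ℕ → ℕ → ℕ → Set
CycleDecompositionWithMatching d N r =
  Σ (Fin r → Cycle d (N * N)) λ C →
    Decomposition C ×
    Σ (Fin r → Fin N → Fin (N * N)) λ p →
      (∀ i → Injective _≡_ _≡_ (p i) × ComponentsArePaths (C i) (p i) (N ∸ 1)) ×
      PerfectMatching C p

module FromSegmented {d n : ℕ} {I : Set} {r : ℕ} (D : SegmentedDecomposition d n I) (index : Fin r ↔ I) (1≤n : 1 ≤ n) where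
  open SegmentedDecomposition D
  open Inverse index using (to; from) renaming (strictlyInverseˡ to to-from; strictlyInverseʳ to from-to)

  private
    N = suc n

    vertex : Fin r → Fin (N * N) → Vertex d
    vertex i k = cycle (to i) (unflatten k)

    vertex-flatten : ∀ i p → vertex i (flatten p) ≡ cycle (to i) p
    vertex-flatten i p = cong (cycle (to i)) (unflatten-flatten p)

    vertex-next-flatten : ∀ i p → vertex i (next (flatten p)) ≡ cycle (to i) (succ p)
    vertex-next-flatten i p = cong (cycle (to i)) (trans (unflatten-next {n} (flatten p)) (cong succ (unflatten-flatten p)))

    segment-succ : ∀ a (s : Fin n) → succ (a , inject₁ s) ≡ (a , fs s)
    segment-succ a s = trans (succ-¬isLast a (inject₁ s) (<⇒¬isLast (inject₁ s) s<n))
                             (cong (a ,_) (toℕ-injective (trans (toℕ-rot1 (inject₁ s) s<n) (cong suc (toℕ-inject₁ s)))))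
      where
      s<n : toℕ (inject₁ s) < n
      s<n = subst (_< n) (sym (toℕ-inject₁ s)) (toℕ<n s)

  cycles : Fin r → Cycle d (N * N)
  cycles i = record
    { len≥3 = ≤-trans (s≤s (s≤s (s≤s z≤n))) (*-mono-≤ {2} {N} {2} {N} (s≤s 1≤n) (s≤s 1≤n))
    ; vert  = vertex i
    ; inj   = λ {x} {y} eq →
                trans (sym (flatten-unflatten {n} x)) (trans (cong flatten (cycle-injective (to i) eq)) (flatten-unflatten {n} y))
    ; adj   = λ k → subst (λ z → Adjacent (vertex i k) (cycle (to i) z)) (sym (unflatten-next {n} k))
                          (cycle-adjacent (to i) (unflatten k))
    }

  decomposition : Decomposition cycles
  decomposition u v a with edge-cover u v a
  ... | (i , p) , s = from i , (flatten p , SameEdge-trans s′ on-cycle) , unique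
    where
    s′ : SameEdge u v (cycle (to (from i)) p) (cycle (to (from i)) (succ p))
    s′ = subst (λ z → SameEdge u v (cycle z p) (cycle z (succ p))) (sym (to-from i)) s
    on-cycle : SameEdge (cycle (to (from i)) p) (cycle (to (from i)) (succ p)) (vertex (from i) (flatten p)) (vertex (from i) (next (flatten p)))
    on-cycle = inj₁ (sym (vertex-flatten (from i) p) , sym (vertex-next-flatten (from i) p))
    unique : ∀ j → EdgeOfCycle (cycles j) u v → j ≡ from i
    unique j (k , s₂) with edge-unique {i} {p} {to j} {unflatten k}
      (SameEdge-trans (SameEdge-sym s) (SameEdge-trans s₂ (inj₁ (refl , cong (cycle (to j)) (unflatten-next {n} k)))))
    ... | e , _ = trans (sym (from-to j)) (cong from (sym e))

  matching : Fin r → Fin N → Fin (N * N)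
  matching i j = flatten (j , fromℕ n)

  matching-injective : ∀ i → Injective _≡_ _≡_ (matching i)
  matching-injective i {x} {y} eq =
    cong proj₁ (trans (sym (unflatten-flatten (x , fromℕ n))) (trans (cong unflatten eq) (unflatten-flatten (y , fromℕ n))))

  segmentPath : Fin r → Fin N → Path d n
  segmentPath i a = record
    { pvert = λ t → cycle (to i) (a , t)
    ; pinj  = λ eq → cong proj₂ (cycle-injective (to i) eq)
    ; padj  = λ s → subst (λ z → Adjacent (cycle (to i) (a , inject₁ s)) (cycle (to i) z)) (segment-succ a s)
                          (cycle-adjacent (to i) (a , inject₁ s))
    }

  components : ∀ i → ComponentsArePaths (cycles i) (matching i) (N ∸ 1)
  components i = segmentPath i , vertex-on-segment , segment-on-cycle , segment-edge-kept , kept-edge-on-segment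
    where
    P = segmentPath i
    C = cycles i

    vertex-on-segment : ∀ (k : Fin (N * N)) → Σ (Fin N × Fin (suc n)) λ (a , t) →
      (pvert (P a) t ≡ vert C k) × (∀ b t′ → pvert (P b) t′ ≡ vert C k → (b , t′) ≡ (a , t))
    vertex-on-segment k = unflatten k , refl , λ b t′ eq → cycle-injective (to i) eq

    segment-on-cycle : ∀ a t → ∃ λ k → pvert (P a) t ≡ vert C k
    segment-on-cycle a t = flatten (a , t) , sym (vertex-flatten i (a , t))

    segment-edge-kept : ∀ a (s : Fin n) → ∃ λ k → (∀ j → matching i j ≢ k) ×
      SameEdge (pvert (P a) (inject₁ s)) (pvert (P a) (fs s)) (vert C k) (vert C (next k))
    segment-edge-kept a s = flatten (a , inject₁ s) , not-matching , inj₁ (sym (vertex-flatten i (a , inject₁ s)) , sym next-vertex)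
      where
      not-matching : ∀ j → matching i j ≢ flatten (a , inject₁ s)
      not-matching j eq = fromℕ≢inject₁ (cong proj₂ (trans (sym (unflatten-flatten (j , fromℕ n)))
                                                        (trans (cong unflatten eq) (unflatten-flatten (a , inject₁ s)))))
      next-vertex : vert C (next (flatten (a , inject₁ s))) ≡ cycle (to i) (a , fs s)
      next-vertex = trans (vertex-next-flatten i (a , inject₁ s)) (cong (cycle (to i)) (segment-succ a s))

    kept-edge-on-segment : ∀ k → (∀ j → matching i j ≢ k) → Σ (Fin N × Fin n) λ (a , s) →
      SameEdge (pvert (P a) (inject₁ s)) (pvert (P a) (fs s)) (vert C k) (vert C (next k))
    kept-edge-on-segment k not-matching = (a , s) , inj₁ (cong (cycle (to i)) (sym k≡) , next-vertex)
      where
      a = proj₁ (unflatten {n} k)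
      t = proj₂ (unflatten {n} k)
      n≢t : n ≢ toℕ t
      n≢t e = not-matching a (trans (cong (λ z → flatten (a , z)) (toℕ-injective (trans (toℕ-fromℕ n) e))) (flatten-unflatten {n} k))
      s = lower₁ t n≢t
      k≡ : unflatten k ≡ (a , inject₁ s)
      k≡ = cong (a ,_) (sym (inject₁-lower₁ t n≢t))
      next-vertex : cycle (to i) (a , fs s) ≡ vert C (next k)
      next-vertex = trans (cong (cycle (to i)) (trans (sym (segment-succ a s)) (cong succ (sym k≡))))
                          (sym (cong (cycle (to i)) (unflatten-next {n} k)))

  matchedSegment : Bool → Fin N → Fin N
  matchedSegment true  j = j
  matchedSegment false j = rot 1 j

  matchingIndex : Bool → Fin N → Fin N
  matchingIndex true  j = j
  matchingIndex false j = rot n j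

  matchingIndex-matchedSegment : ∀ e j → matchingIndex e (matchedSegment e j) ≡ j
  matchingIndex-matchedSegment true  j = refl
  matchingIndex-matchedSegment false j = rotn-rot1 j

  onMatching⇒segmentEnd : ∀ i j v → OnEdge (cycles i) (matching i j) v →
                          Σ Bool λ e → v ≡ cycle (to i) (matchedSegment e j , segmentEnd e)
  onMatching⇒segmentEnd i j v (inj₁ eq) = true , trans eq (vertex-flatten i (j , fromℕ n))
  onMatching⇒segmentEnd i j v (inj₂ eq) =
    false , trans eq (trans (vertex-next-flatten i (j , fromℕ n)) (cong (cycle (to i)) (succ-fromℕ j)))

  segmentEnd⇒onMatching : ∀ i e j → OnEdge (cycles (from i)) (matching (from i) (matchingIndex e j)) (cycle i (j , segmentEnd e))
  segmentEnd⇒onMatching i true  j =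
    inj₁ (sym (trans (vertex-flatten (from i) (j , fromℕ n)) (cong (λ z → cycle z (j , fromℕ n)) (to-from i))))
  segmentEnd⇒onMatching i false j =
    inj₂ (sym (trans (vertex-next-flatten (from i) (rot n j , fromℕ n))
                     (cong₂ cycle (to-from i) (trans (succ-fromℕ (rot n j)) (cong (_, fz) (rot1-rotn j))))))

  perfectMatching : PerfectMatching cycles matching
  perfectMatching v with end-cover v
  ... | (i , j , e) , refl = (from i , matchingIndex e j) , segmentEnd⇒onMatching i e j , unique
    where
    unique : ∀ i′ j′ → OnEdge (cycles i′) (matching i′ j′) (cycle i (j , segmentEnd e)) → (i′ , j′) ≡ (from i , matchingIndex e j)
    unique i′ j′ on with onMatching⇒segmentEnd i′ j′ _ on
    ... | e′ , eq with end-unique {i} {j} {e} {to i′} {matchedSegment e′ j′} {e′} eq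
    ... | refl , refl , refl = cong₂ _,_ (sym (from-to i′)) (sym (matchingIndex-matchedSegment e′ j′))

  decomposition-with-matching : CycleDecompositionWithMatching d N r
  decomposition-with-matching = cycles , decomposition , matching , (λ i → matching-injective i , components i) , perfectMatching

allVertices? : ∀ d {P : Vertex d → Set} → (∀ v → Dec (P v)) → Dec (∀ v → P v)
allVertices? zero    P? = map′ (λ p → λ { [] → p }) (λ f → f []) (P? [])
allVertices? (suc d) P? =
  map′ (λ (f , g) → λ { (true ∷ v) → f v ; (false ∷ v) → g v }) (λ h → (λ v → h (true ∷ v)) , (λ v → h (false ∷ v)))
       (allVertices? d (λ v → P? (true ∷ v)) ×-dec allVertices? d (λ v → P? (false ∷ v)))

anyVertex? : ∀ d {P : Vertex d → Set} → (∀ v → Dec (P v)) → Dec (Σ (Vertex d) P)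
anyVertex? zero    P? = map′ ([] ,_) (λ { ([] , p) → p }) (P? [])
anyVertex? (suc d) P? =
  map′ (λ { (inj₁ (v , p)) → true ∷ v , p ; (inj₂ (v , p)) → false ∷ v , p })
       (λ { (true ∷ v , p) → inj₁ (v , p) ; (false ∷ v , p) → inj₂ (v , p) })
       (anyVertex? d (λ v → P? (true ∷ v)) ⊎-dec anyVertex? d (λ v → P? (false ∷ v)))

allBool? : ∀ {P : Bool → Set} → (∀ b → Dec (P b)) → Dec (∀ b → P b)
allBool? P? = map′ (λ (t , f) → λ { true → t ; false → f }) (λ h → h true , h false) (P? true ×-dec P? false)

anyBool? : ∀ {P : Bool → Set} → (∀ b → Dec (P b)) → Dec (Σ Bool P)
anyBool? P? = map′ (λ { (inj₁ p) → true , p ; (inj₂ p) → false , p }) (λ { (true , p) → inj₁ p ; (false , p) → inj₂ p })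
                   (P? true ⊎-dec P? false)

allPos? : ∀ {n} {P : Pos n → Set} → (∀ p → Dec (P p)) → Dec (∀ p → P p)
allPos? P? = map′ (λ f (a , b) → f a b) (λ g a b → g (a , b)) (all? λ a → all? λ b → P? (a , b))

anyPos? : ∀ {n} {P : Pos n → Set} → (∀ p → Dec (P p)) → Dec (Σ (Pos n) P)
anyPos? P? = map′ (λ (a , b , p) → (a , b) , p) (λ ((a , b) , p) → a , b , p) (any? λ a → any? λ b → P? (a , b))

Adjacent? : ∀ {d} (u v : Vertex d) → Dec (Adjacent u v)
Adjacent? u v = any? λ i → ¬? (lookup u i Bool.≟ lookup v i) ×-dec all? λ j → ¬? (j Fin.≟ i) →-dec (lookup u j Bool.≟ lookup v j)

_≟ᵥ_ : ∀ {d} (u v : Vertex d) → Dec (u ≡ v)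
_≟ᵥ_ = ≡-dec-Vec Bool._≟_

SameEdge? : ∀ {d} (u v a b : Vertex d) → Dec (SameEdge u v a b)
SameEdge? u v a b = (u ≟ᵥ a ×-dec v ≟ᵥ b) ⊎-dec (u ≟ᵥ b ×-dec v ≟ᵥ a)

_≟ₚ_ : ∀ {n} (p q : Pos n) → Dec (p ≡ q)
_≟ₚ_ = ≡-dec-× Fin._≟_ Fin._≟_

module Checked {d n r} (C : Fin r → Pos n → Vertex d) where
  IsSegmented : Set
  IsSegmented =
    (∀ i p q → C i p ≡ C i q → p ≡ q) ×
    (∀ i p → Adjacent (C i p) (C i (succ p))) ×
    (∀ u v → Adjacent u v → Σ (Fin r × Pos n) λ (i , p) → SameEdge u v (C i p) (C i (succ p))) ×
    (∀ i p i′ p′ → SameEdge (C i p) (C i (succ p)) (C i′ p′) (C i′ (succ p′)) → (i , p) ≡ (i′ , p′)) ×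
    (∀ v → Σ (Fin r × Fin (suc n) × Bool) λ (i , j , e) → v ≡ C i (j , segmentEnd e)) ×
    (∀ i j e i′ j′ e′ → C i (j , segmentEnd e) ≡ C i′ (j′ , segmentEnd e′) → (i , j , e) ≡ (i′ , j′ , e′))

  isSegmented? : Dec IsSegmented
  isSegmented? =
    (all? λ i → allPos? λ p → allPos? λ q → C i p ≟ᵥ C i q →-dec p ≟ₚ q) ×-dec
    (all? λ i → allPos? λ p → Adjacent? (C i p) (C i (succ p))) ×-dec
    (allVertices? d λ u → allVertices? d λ v → Adjacent? u v →-dec
       map′ (λ (i , p , s) → (i , p) , s) (λ ((i , p) , s) → i , p , s)
            (any? λ i → anyPos? λ p → SameEdge? u v (C i p) (C i (succ p)))) ×-dec
    (all? λ i → allPos? λ p → all? λ i′ → allPos? λ p′ →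
       SameEdge? (C i p) (C i (succ p)) (C i′ p′) (C i′ (succ p′)) →-dec ≡-dec-× Fin._≟_ _≟ₚ_ (i , p) (i′ , p′)) ×-dec
    (allVertices? d λ v → map′ (λ (i , j , e , eq) → (i , j , e) , eq) (λ ((i , j , e) , eq) → i , j , e , eq)
       (any? λ i → any? λ j → anyBool? λ e → v ≟ᵥ C i (j , segmentEnd e))) ×-dec
    (all? λ i → all? λ j → allBool? λ e → all? λ i′ → all? λ j′ → allBool? λ e′ →
       C i (j , segmentEnd e) ≟ᵥ C i′ (j′ , segmentEnd e′) →-dec ≡-dec-× Fin._≟_ (≡-dec-× Fin._≟_ Bool._≟_) (i , j , e) (i′ , j′ , e′))

  segmented : IsSegmented → SegmentedDecomposition d n (Fin r)
  segmented (inj , adj , cover , unique , endCover , endUnique) = record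
    { cycle           = C
    ; cycle-injective = λ i {p} {q} → inj i p q
    ; cycle-adjacent  = adj
    ; edge-cover      = cover
    ; edge-unique     = λ {i} {p} {i′} {p′} s → ,-injective (unique i p i′ p′ s)
    ; end-cover       = endCover
    ; end-unique      = λ {i} {j} {e} {i′} {j′} {e′} eq →
                          let (ei , r) = ,-injective (endUnique i j e i′ j′ e′ eq) in ei , ,-injective r
    }

pattern 𝟎 = false
pattern 𝟏 = true

opaque
  unfolding rot isLast

  Q₂ : SegmentedDecomposition 2 1 (Fin 1)
  Q₂ = Checked.segmented C (toWitness {a? = Checked.isSegmented? C} _)
    where
    cycles : Vec (Vec (Vec (Vertex 2) 2) 2) 1
    cycles = ( ((𝟎 ∷ 𝟎 ∷ []) ∷ (𝟏 ∷ 𝟎 ∷ []) ∷ [])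
             ∷ ((𝟏 ∷ 𝟏 ∷ []) ∷ (𝟎 ∷ 𝟏 ∷ []) ∷ [])
             ∷ [] ) ∷ []
    C : Fin 1 → Pos 1 → Vertex 2
    C i (j , t) = lookup (lookup (lookup cycles i) j) t

  Q₄ : SegmentedDecomposition 4 3 (Fin 2)
  Q₄ = Checked.segmented C (toWitness {a? = Checked.isSegmented? C} _)
    where
    cycles : Vec (Vec (Vec (Vertex 4) 4) 4) 2
    cycles = ( ((𝟏 ∷ 𝟎 ∷ 𝟎 ∷ 𝟎 ∷ []) ∷ (𝟏 ∷ 𝟏 ∷ 𝟎 ∷ 𝟎 ∷ []) ∷ (𝟎 ∷ 𝟏 ∷ 𝟎 ∷ 𝟎 ∷ []) ∷ (𝟎 ∷ 𝟏 ∷ 𝟏 ∷ 𝟎 ∷ []) ∷ [])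
             ∷ ((𝟏 ∷ 𝟏 ∷ 𝟏 ∷ 𝟎 ∷ []) ∷ (𝟏 ∷ 𝟎 ∷ 𝟏 ∷ 𝟎 ∷ []) ∷ (𝟏 ∷ 𝟎 ∷ 𝟏 ∷ 𝟏 ∷ []) ∷ (𝟏 ∷ 𝟎 ∷ 𝟎 ∷ 𝟏 ∷ []) ∷ [])
             ∷ ((𝟎 ∷ 𝟎 ∷ 𝟎 ∷ 𝟏 ∷ []) ∷ (𝟎 ∷ 𝟏 ∷ 𝟎 ∷ 𝟏 ∷ []) ∷ (𝟏 ∷ 𝟏 ∷ 𝟎 ∷ 𝟏 ∷ []) ∷ (𝟏 ∷ 𝟏 ∷ 𝟏 ∷ 𝟏 ∷ []) ∷ [])
             ∷ ((𝟎 ∷ 𝟏 ∷ 𝟏 ∷ 𝟏 ∷ []) ∷ (𝟎 ∷ 𝟎 ∷ 𝟏 ∷ 𝟏 ∷ []) ∷ (𝟎 ∷ 𝟎 ∷ 𝟏 ∷ 𝟎 ∷ []) ∷ (𝟎 ∷ 𝟎 ∷ 𝟎 ∷ 𝟎 ∷ []) ∷ [])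
             ∷ [] )
           ∷ ( ((𝟎 ∷ 𝟏 ∷ 𝟎 ∷ 𝟏 ∷ []) ∷ (𝟎 ∷ 𝟏 ∷ 𝟏 ∷ 𝟏 ∷ []) ∷ (𝟎 ∷ 𝟏 ∷ 𝟏 ∷ 𝟎 ∷ []) ∷ (𝟎 ∷ 𝟎 ∷ 𝟏 ∷ 𝟎 ∷ []) ∷ [])
             ∷ ((𝟏 ∷ 𝟎 ∷ 𝟏 ∷ 𝟎 ∷ []) ∷ (𝟏 ∷ 𝟎 ∷ 𝟎 ∷ 𝟎 ∷ []) ∷ (𝟏 ∷ 𝟎 ∷ 𝟎 ∷ 𝟏 ∷ []) ∷ (𝟏 ∷ 𝟏 ∷ 𝟎 ∷ 𝟏 ∷ []) ∷ [])
             ∷ ((𝟏 ∷ 𝟏 ∷ 𝟎 ∷ 𝟎 ∷ []) ∷ (𝟏 ∷ 𝟏 ∷ 𝟏 ∷ 𝟎 ∷ []) ∷ (𝟏 ∷ 𝟏 ∷ 𝟏 ∷ 𝟏 ∷ []) ∷ (𝟏 ∷ 𝟎 ∷ 𝟏 ∷ 𝟏 ∷ []) ∷ [])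
             ∷ ((𝟎 ∷ 𝟎 ∷ 𝟏 ∷ 𝟏 ∷ []) ∷ (𝟎 ∷ 𝟎 ∷ 𝟎 ∷ 𝟏 ∷ []) ∷ (𝟎 ∷ 𝟎 ∷ 𝟎 ∷ 𝟎 ∷ []) ∷ (𝟎 ∷ 𝟏 ∷ 𝟎 ∷ 𝟎 ∷ []) ∷ [])
             ∷ [] )
           ∷ []
    C : Fin 2 → Pos 3 → Vertex 4
    C i (j , t) = lookup (lookup (lookup cycles i) j) t

level : ℕ → ℕ
level zero    = 0
level (suc i) = odd (level i)

dim : ℕ → ℕ
dim zero    = 4
dim (suc i) = dim i + dim i

TowerIndex : ℕ → Set
TowerIndex zero    = Fin 2
TowerIndex (suc i) = TowerIndex i × TowerIndex i × Bool × Fin (suc (odd (level i)))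

tower : ∀ i → SegmentedDecomposition (dim i) (odd (odd (level i))) (TowerIndex i)
tower zero    = Q₄
tower (suc i) = Doubling.double (level i) (tower i)

count : ℕ → ℕ
count zero    = 2
count (suc i) = count i * (count i * (2 * suc (odd (level i))))

tower-index : ∀ i → Fin (count i) ↔ TowerIndex i
tower-index zero    = ↔-refl
tower-index (suc i) =
  ↔-trans *↔× (tower-index i ×-↔ ↔-trans *↔× (tower-index i ×-↔ ↔-trans *↔× (2↔Bool ×-↔ ↔-refl)))

2^-double : ∀ j → 2 ^ suc j ≡ 2 ^ j + 2 ^ j
2^-double j = cong (2 ^ j +_) (+-identityʳ (2 ^ j))

dim≡ : ∀ i → dim i ≡ 2 ^ (2 + i)
dim≡ zero    = refl
dim≡ (suc i) = trans (cong₂ _+_ (dim≡ i) (dim≡ i)) (sym (2^-double (2 + i)))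

segments≡ : ∀ i → suc (odd (odd (level i))) ≡ 2 ^ (2 + i)
segments≡ zero    = refl
segments≡ (suc i) = trans (cong₂ _+_ (segments≡ i) (segments≡ i)) (sym (2^-double (2 + i)))

half≡ : ∀ i → suc (odd (level i)) ≡ 2 ^ (1 + i)
half≡ zero    = refl
half≡ (suc i) = segments≡ i

3+i≤2^[2+i] : ∀ i → 3 + i ≤ 2 ^ (2 + i)
3+i≤2^[2+i] zero    = s≤s (s≤s (s≤s z≤n))
3+i≤2^[2+i] (suc i) = begin
  4 + i                ≤⟨ m≤m+n (4 + i) (2 + i) ⟩
  (4 + i) + (2 + i)    ≡⟨ +-suc (3 + i) (2 + i) ⟨
  (3 + i) + (3 + i)    ≤⟨ +-mono-≤ (3+i≤2^[2+i] i) (3+i≤2^[2+i] i) ⟩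
  2 ^ (2 + i) + 2 ^ (2 + i) ≡⟨ 2^-double (2 + i) ⟨
  2 ^ (3 + i)          ∎
  where open ≤-Reasoning

exponent : ℕ → ℕ
exponent i = 2 ^ (2 + i) ∸ 1 ∸ (2 + i)

exponent-suc : ∀ i → exponent (suc i) ≡ exponent i + (exponent i + (2 + i))
exponent-suc i = begin
  2 ^ (3 + i) ∸ 1 ∸ (3 + i)                    ≡⟨ cong (λ z → z ∸ 1 ∸ (3 + i)) (2^-double (2 + i)) ⟩
  (P + P) ∸ 1 ∸ (3 + i)                        ≡⟨ ∸-+-assoc (P + P) 1 (3 + i) ⟩
  (P + P) ∸ (4 + i)                            ≡⟨ cong (λ z → (z + z) ∸ (4 + i)) (m∸n+n≡m (3+i≤2^[2+i] i)) ⟨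
  ((E + (3 + i)) + (E + (3 + i))) ∸ (4 + i)    ≡⟨ cong (_∸ (4 + i)) (regroup E i) ⟩
  ((E + (E + (2 + i))) + (4 + i)) ∸ (4 + i)    ≡⟨ m+n∸n≡m _ (4 + i) ⟩
  E + (E + (2 + i))                            ≡⟨ cong (λ z → z + (z + (2 + i))) (∸-+-assoc P 1 (2 + i)) ⟨
  exponent i + (exponent i + (2 + i))          ∎
  where
  open ≡-Reasoning
  P = 2 ^ (2 + i)
  E = P ∸ (3 + i)
  regroup : ∀ e i → (e + (3 + i)) + (e + (3 + i)) ≡ (e + (e + (2 + i))) + (4 + i)
  regroup = solve-∀

count≡ : ∀ i → count i ≡ 2 ^ exponent i
count≡ zero    = refl
count≡ (suc i) = begin
  count i * (count i * (2 * suc (odd (level i))))  ≡⟨ cong₂ (λ a b → a * (a * (2 * b))) (count≡ i) (half≡ i) ⟩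
  2 ^ E * (2 ^ E * 2 ^ (2 + i))                    ≡⟨ cong (2 ^ E *_) (^-distribˡ-+-* 2 E (2 + i)) ⟨
  2 ^ E * 2 ^ (E + (2 + i))                        ≡⟨ ^-distribˡ-+-* 2 E (E + (2 + i)) ⟨
  2 ^ (E + (E + (2 + i)))                          ≡⟨ cong (2 ^_) (exponent-suc i) ⟨
  2 ^ exponent (suc i)                             ∎
  where
  open ≡-Reasoning
  E = exponent i

tower-decomposition : ∀ i → CycleDecompositionWithMatching (2 ^ (2 + i)) (2 ^ (2 + i)) (2 ^ exponent i)
tower-decomposition i =
  subst₂ (λ d r → CycleDecompositionWithMatching d (2 ^ (2 + i)) r) (dim≡ i) (count≡ i)
    (subst (λ N → CycleDecompositionWithMatching (dim i) N (count i)) (segments≡ i)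
      (FromSegmented.decomposition-with-matching (tower i) (tower-index i) (≤-trans (s≤s z≤n) (m≤n+m _ _))))

theorem3p1 : (m : ℕ) → 1 ≤ m →
    Σ (Fin (2 ^ (2 ^ m ∸ 1 ∸ m)) → Cycle (2 ^ m) (2 ^ m * 2 ^ m)) λ C →
    Decomposition C ×
    Σ (Fin (2 ^ (2 ^ m ∸ 1 ∸ m)) → Fin (2 ^ m) → Fin (2 ^ m * 2 ^ m)) λ p →
    (∀ i → Injective _≡_ _≡_ (p i) × ComponentsArePaths (C i) (p i) (2 ^ m ∸ 1)) ×
    PerfectMatching C p
theorem3p1 (suc zero)    _ = FromSegmented.decomposition-with-matching Q₂ ↔-refl ≤-refl
theorem3p1 (suc (suc i)) _ = tower-decomposition i
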